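{- Let $G=(V,E)$ be a non-complete Random Apollonian Network on $n$ vertices and let $T=(V_T,E_T)$ be its (unique) clique-tree. Then: (1) $|V_T| = |\mathbb{Q}| = n-3$; (2) $|E_T| = |\mathbb{S}| = n-4$; (3) the number of leaves of $T$ equals the number of simplicial vertices of $G$; (4) the maximal cliques corresponding to internal vertices of $T$ contain only vertices of $G$ that belong to minimal vertex separators of $G$; (5) every vertex of $T$ has degree at most $4$.
   Context: A Random Apollonian Network (RAN) is a graph obtained by starting from a triangle embedded in the plane and repeatedly choosing a bounded triangular face of the current plane graph, inserting a new vertex inside it and joining it to the three vertices of that face. RANs are exactly the planar $3$-trees (the maximal planar chordal graphs); they are uniquely representable chordal graphs, i.e. they have exactly one clique-tree. A vertex is simplicial if its neighbourhood is a clique. For a chordal graph $G$, the clique-intersection graph has the maximal cliques of $G$ as vertices, with an edge between two maximal cliques when they intersect, weighted by the size of the intersection; a clique-tree of $G$ is a maximum-weight spanning tree of the clique-intersection graph. Each vertex $q$ of the clique-tree corresponds to a maximal clique $Q$. $\mathbb{Q}$ denotes the set of maximal cliques of $G$. For non-adjacent vertices $u,v$, a set $S\subset V$ is a $uv$-separator if removing $S$ puts $u$ and $v$ in distinct components, and a minimal vertex separator is a $uv$-separator (for some $u,v$) no proper subset of which is a $uv$-separator; $\mathbb{S}$ denotes the set of minimal vertex separators of $G$. -}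

module Defs where

open import Data.Nat using (ℕ; zero; suc; _+_; _≤_; _<ᵇ_; _∸_)
open import Data.Bool using (Bool; true; false; not; _∨_; if_then_else_)
open import Data.Fin using (Fin; zero; suc; toℕ; inject₁; fromℕ; _≟_)
open import Data.Fin.Subset using (Subset; _∈_; _∉_; _⊆_; _⊂_; _∩_; ∣_∣; Nonempty)
open import Data.Fin.Permutation using (Permutation′; _⟨$⟩ʳ_)
open import Data.List using (List; []; _∷_; length; map; allFin)
open import Data.Nat.ListAction using (sum)
open import Data.List.Relation.Unary.Any using (Any; _─_)
open import Data.List.Relation.Unary.Unique.Propositional using (Unique)
import Data.List.Membership.Propositional as LM
open import Data.Maybe using (Maybe; just; nothing)
import Data.Maybe as Maybe
open import Data.Product using (Σ; ∃; ∃-syntax; _×_; _,_)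
open import Relation.Nullary using (¬_; does)
open import Relation.Binary.PropositionalEquality using (_≡_; _≢_)

HasCard : {A : Set} → (A → Set) → ℕ → Set
HasCard {A} P k =
  Σ (List A) λ xs → Unique xs × (∀ x → x LM.∈ xs → P x)
                  × (∀ x → P x → x LM.∈ xs) × length xs ≡ k

Graph : ℕ → Set
Graph n = Fin n → Fin n → Bool

module _ {n : ℕ} (G : Graph n) where

  Adj : Fin n → Fin n → Set
  Adj u v = G u v ≡ true

  -- a walk u = x₀, x₁, …, x_k = v, recorded as its list of vertices
  data Walk : Fin n → Fin n → List (Fin n) → Set where
    stop : ∀ {u} → Walk u u (u ∷ [])
    step : ∀ {u w v xs} → Adj u w → Walk w v xs → Walk u v (u ∷ xs)

  Connected : Set
  Connected = ∀ u v → ∃[ xs ] Walk u v xs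

  -- a cycle: distinct vertices x₀ … x_k (k ≥ 2) with consecutive
  -- vertices adjacent and x_k adjacent to x₀
  HasCycle : Set
  HasCycle = ∃[ u ] ∃[ w ] ∃[ xs ]
               (Walk u w xs × Unique xs × 3 ≤ length xs × Adj w u)

  IsTree : Set
  IsTree = Connected × ¬ HasCycle

  degree : Fin n → ℕ
  degree u = sum (map (λ v → if G u v then 1 else 0) (allFin n))

  IsClique : Subset n → Set
  IsClique S = ∀ u v → u ∈ S → v ∈ S → u ≢ v → Adj u v

  IsMaximalClique : Subset n → Set
  IsMaximalClique Q = IsClique Q × (∀ S → IsClique S → Q ⊆ S → S ⊆ Q)

  IsSimplicial : Fin n → Set
  IsSimplicial v = ∀ a b → Adj v a → Adj v b → a ≢ b → Adj a b

  IsSeparator : Fin n → Fin n → Subset n → Set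
  IsSeparator u v S =
    u ≢ v × ¬ Adj u v × u ∉ S × v ∉ S
    × (∀ xs → Walk u v xs → Any (_∈ S) xs)

  IsMinimalSeparatorFor : Fin n → Fin n → Subset n → Set
  IsMinimalSeparatorFor u v S =
    IsSeparator u v S × (∀ S′ → S′ ⊂ S → ¬ IsSeparator u v S′)

  IsMinimalVertexSeparator : Subset n → Set
  IsMinimalVertexSeparator S = ∃[ u ] ∃[ v ] IsMinimalSeparatorFor u v S

  NonComplete : Set
  NonComplete = ∃[ u ] ∃[ v ] (u ≢ v × ¬ Adj u v)

  Symmetric : Set
  Symmetric = ∀ u v → G u v ≡ G v u

  Irreflexive : Set
  Irreflexive = ∀ u → G u u ≡ false

-- Random Apollonian Networks, via their construction process.
-- The state records the graph and the list of bounded (triangular) faces.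

-- last ↦ nothing, inject₁ i ↦ just i
pred? : ∀ {n} → Fin (suc n) → Maybe (Fin n)
pred? {zero} zero = nothing
pred? {suc n} zero = just zero
pred? {suc n} (suc i) = Maybe.map suc (pred? i)

triangle : Graph 3
triangle u v = not (does (u ≟ v))

Face : ℕ → Set
Face n = Fin n × Fin n × Fin n

inFace : ∀ {n} → Face n → Fin n → Bool
inFace (a , b , c) x = does (x ≟ a) ∨ does (x ≟ b) ∨ does (x ≟ c)

-- insert a new vertex (the last one) joined to a, b, c
insertVertex : ∀ {n} → Graph n → Face n → Graph (suc n)
insertVertex E f x y with pred? x | pred? y
... | just x′ | just y′ = E x′ y′
... | nothing | just y′ = inFace f y′
... | just x′ | nothing = inFace f x′
... | nothing | nothing = false

injFace : ∀ {n} → Face n → Face (suc n)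
injFace (a , b , c) = inject₁ a , inject₁ b , inject₁ c

data RANState : (n : ℕ) → Graph n → List (Face n) → Set where
  start : RANState 3 triangle ((zero , suc zero , suc (suc zero)) ∷ [])
  insert : ∀ {n E F a b c} → RANState n E F → (p : (a , b , c) LM.∈ F) →
           RANState (suc n) (insertVertex E (a , b , c))
             ((inject₁ a , inject₁ b , fromℕ n)
              ∷ (inject₁ a , inject₁ c , fromℕ n)
              ∷ (inject₁ b , inject₁ c , fromℕ n)
              ∷ map injFace (F ─ p))

IsRAN : ∀ {n} → Graph n → Set
IsRAN {n} G = ∃[ E ] ∃[ F ] Σ (Permutation′ n) λ σ →
  RANState n E F × (∀ u v → G (σ ⟨$⟩ʳ u) (σ ⟨$⟩ʳ v) ≡ E u v)

module _ {m n : ℕ} (cl : Fin m → Subset n) where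

  IsCliqueIntersectionSpanningTree : Graph m → Set
  IsCliqueIntersectionSpanningTree T =
    Symmetric T × Irreflexive T × IsTree T
    × (∀ i j → Adj T i j → Nonempty (cl i ∩ cl j))

  weight : Graph m → ℕ
  weight T = sum (map (λ i → sum (map (λ j →
    if (toℕ i <ᵇ toℕ j) then (if T i j then ∣ cl i ∩ cl j ∣ else 0) else 0)
    (allFin m))) (allFin m))

-- A clique-tree of G: the maximal cliques are enumerated bijectively by
-- Fin m (the vertices of T), and T is a maximum-weight spanning tree of
-- the clique-intersection graph.
record CliqueTree {n : ℕ} (G : Graph n) : Set where
  field
    m       : ℕ
    clique  : Fin m → Subset n
    injective : ∀ i j → clique i ≡ clique j → i ≡ j
    maximal   : ∀ i → IsMaximalClique G (clique i)
    complete  : ∀ Q → IsMaximalClique G Q → ∃[ i ] clique i ≡ Q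
    tree      : Graph m
    spanning  : IsCliqueIntersectionSpanningTree clique tree
    maxWeight : ∀ T′ → IsCliqueIntersectionSpanningTree clique T′ →
                weight clique T′ ≤ weight clique tree

  -- edges of T as unordered pairs {i,j}, represented with i < j
  IsTreeEdge : Fin m × Fin m → Set
  IsTreeEdge (i , j) = (toℕ i <ᵇ toℕ j) ≡ true × Adj tree i j

  IsLeaf : Fin m → Set
  IsLeaf q = degree tree q ≡ 1

  IsInternal : Fin m → Set
  IsInternal q = 2 ≤ degree tree q

module Submission where

-- A RAN on n ≥ 4 vertices arises from K₄ by n − 4 vertex insertions.  Along the
-- construction we keep an explicit description of its maximal cliques (RANInvariant):
-- there are M = n − 3 of them, and clique i consists of a new vertex ν i together with a
-- face fa i, fb i, fc i of an older clique par i.  So the cliques form a rooted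
-- "construction tree" T* with M − 1 edges.
--
-- Next, every
-- maximum-weight spanning tree is T*, since the weight 3(M − 1) of T* can only be
-- reached with edges of T*.

open import Defs
open import Data.Nat using (ℕ; zero; suc; _+_; _*_; _∸_; _≤_; _<_; _<ᵇ_; z≤n; s≤s; _≤?_) renaming (_≟_ to _≟ℕ_)
open import Data.Nat.Properties hiding (_≟_; _≤?_)
open import Data.Nat.ListAction using (sum)
open import Data.Nat.ListAction.Properties using (sum-++)
open import Data.Bool using (Bool; true; false; not; _∨_; _∧_; if_then_else_; T)
import Data.Bool as Bool
open import Data.Bool.Properties using (∨-comm; ∨-zeroʳ)
open import Data.Unit using (tt)
open import Data.Empty using (⊥; ⊥-elim)
open import Data.Product using (Σ; ∃-syntax; _×_; _,_; proj₁; proj₂)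
open import Data.Sum using (_⊎_; inj₁; inj₂; swap; [_,_])
open import Data.Maybe using (just; nothing; maybe)
open import Data.Fin using (Fin; zero; suc; toℕ; inject₁; fromℕ; _≟_)
open import Data.Fin.Properties using (toℕ-injective; fromℕ≢inject₁; inject₁-injective; toℕ-inject₁; toℕ-fromℕ; toℕ<n) renaming (suc-injective to fsuc-injective)
open import Data.Fin.Subset using (Subset; inside; outside; _∈_; _∉_; _⊆_; _⊂_; _∩_; _∪_; ∣_∣; ⁅_⁆; Nonempty)
open import Data.Fin.Subset.Properties using (_∈?_; ⊆-antisym; x∈p∩q⁺; x∈p∩q⁻; x∈⁅x⁆; x∈⁅y⁆⇒x≡y; ∩-comm; x∈p∪q⁺; x∈p∪q⁻)
open import Data.Fin.Permutation using (Permutation′; _⟨$⟩ʳ_; _⟨$⟩ˡ_; inverseˡ; inverseʳ)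
open import Data.Vec using (tabulate; []; _∷_)
open import Data.Vec.Base using (_[_]=_)
open _[_]=_
open import Data.Vec.Properties using (lookup∘tabulate; []=⇒lookup; lookup⇒[]=)
open import Data.List using (List; []; _∷_; length; map; allFin; cartesianProduct; filter; _++_; reverse)
import Data.List.Properties as List
open import Data.List.Membership.Propositional using (find) renaming (_∈_ to _∈ˡ_)
open import Data.List.Membership.Propositional.Properties using (∈-map⁺; ∈-map⁻; ∈-allFin; ∈-filter⁺; ∈-filter⁻; ∈-cartesianProduct⁺)
open import Data.List.Relation.Unary.Any using (Any; here; there; _─_)
open import Data.List.Relation.Unary.Any.Properties using () renaming (reverse⁻ to Any-reverse⁻)
open import Data.List.Relation.Unary.All using (All; []; _∷_)
import Data.List.Relation.Unary.All as All
open import Data.List.Relation.Unary.All.Properties using (¬All⇒Any¬; ¬Any⇒All¬; All¬⇒¬Any; ─⁺) renaming (map⁺ to All-map⁺)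
open import Data.List.Relation.Unary.AllPairs using (AllPairs; []; _∷_)
open import Data.List.Relation.Unary.Unique.Propositional using (Unique)
import Data.List.Relation.Unary.Unique.Propositional.Properties as Unique
open import Relation.Nullary using (¬_; Dec; yes; no; does)
open import Relation.Nullary.Decidable using (dec-true; dec-false; _×-dec_; _⊎-dec_)
open import Relation.Unary.Properties using (∁?)
open import Relation.Binary.PropositionalEquality using (_≡_; _≢_; refl; sym; trans; cong; cong₂; subst; subst₂; module ≡-Reasoning)
open import Relation.Binary.Definitions using (tri<; tri≈; tri>)
import Data.List.Relation.Unary.AllPairs as AllPairs
import Data.List.Relation.Unary.AllPairs.Properties as AllPairs
open import Function using (_∘_)

private variable A B : Set

does-true : ∀ {P : Set} (d : Dec P) → does d ≡ true → P
does-true (yes p) _ = p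

remove : {x : A} (ys : List A) → x ∈ˡ ys → List A
remove (y ∷ ys) (here _) = ys
remove (y ∷ ys) (there p) = y ∷ remove ys p

length-remove : {x : A} (ys : List A) (p : x ∈ˡ ys) → length ys ≡ suc (length (remove ys p))
length-remove (y ∷ ys) (here _) = refl
length-remove (y ∷ ys) (there p) = cong suc (length-remove ys p)

∈-remove : {x y : A} (ys : List A) (p : x ∈ˡ ys) → y ∈ˡ ys → y ≢ x → y ∈ˡ remove ys p
∈-remove (z ∷ ys) (here refl) (here refl) y≢x = ⊥-elim (y≢x refl)
∈-remove (z ∷ ys) (here refl) (there q) _ = q
∈-remove (z ∷ ys) (there p) (here refl) _ = here refl
∈-remove (z ∷ ys) (there p) (there q) y≢x = there (∈-remove ys p q y≢x)

remove-unique : {x : A} (ys : List A) (p : x ∈ˡ ys) → Unique ys → Unique (remove ys p)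
remove-unique (y ∷ ys) (here _) (_ ∷ u) = u
remove-unique (y ∷ ys) (there p) (y∉ ∷ u) = All.tabulate (λ z∈ → All.lookup y∉ (remove-⊆ ys p z∈)) ∷ remove-unique ys p u
  where
  remove-⊆ : ∀ {x z} (zs : List A) (q : x ∈ˡ zs) → z ∈ˡ remove zs q → z ∈ˡ zs
  remove-⊆ (_ ∷ zs) (here _) z∈ = there z∈
  remove-⊆ (_ ∷ zs) (there q) (here e) = here e
  remove-⊆ (_ ∷ zs) (there q) (there z∈) = there (remove-⊆ zs q z∈)

unique-⊆-length : (xs ys : List A) → Unique xs → (∀ x → x ∈ˡ xs → x ∈ˡ ys) → length xs ≤ length ys
unique-⊆-length [] ys _ _ = z≤n
unique-⊆-length (x ∷ xs) ys (x∉xs ∷ u) sub = begin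
  suc (length xs)             ≤⟨ s≤s (unique-⊆-length xs (remove ys p) u sub′) ⟩
  suc (length (remove ys p))  ≡⟨ sym (length-remove ys p) ⟩
  length ys                   ∎
  where
  open ≤-Reasoning
  p : x ∈ˡ ys
  p = sub x (here refl)
  sub′ : ∀ y → y ∈ˡ xs → y ∈ˡ remove ys p
  sub′ y y∈xs = ∈-remove ys p (sub y (there y∈xs)) (λ y≡x → All.lookup x∉xs y∈xs (sym y≡x))

unique-map : (f : A → B) (xs : List A) → Unique xs →
             (∀ x y → x ∈ˡ xs → y ∈ˡ xs → f x ≡ f y → x ≡ y) → Unique (map f xs)
unique-map f [] _ _ = []
unique-map f (x ∷ xs) (x∉xs ∷ u) inj =
  All-map⁺ (All.tabulate λ {y} y∈xs fx≡fy → All.lookup x∉xs y∈xs (inj x y (here refl) (there y∈xs) fx≡fy))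
  ∷ unique-map f xs u (λ y z y∈ z∈ → inj y z (there y∈) (there z∈))

injective-length : (f : A → B) (xs : List A) (ys : List B) → Unique xs →
                   (∀ x y → x ∈ˡ xs → y ∈ˡ xs → f x ≡ f y → x ≡ y) →
                   (∀ x → x ∈ˡ xs → f x ∈ˡ ys) → length xs ≤ length ys
injective-length f xs ys u inj into =
  subst (_≤ length ys) (List.length-map f xs)
    (unique-⊆-length (map f xs) ys (unique-map f xs u inj)
       (λ y y∈ → let (x , x∈ , y≡fx) = ∈-map⁻ f y∈ in subst (_∈ˡ ys) (sym y≡fx) (into x x∈)))

HasCard-unique : {P : A → Set} {k k′ : ℕ} → HasCard P k → HasCard P k′ → k ≡ k′
HasCard-unique (xs , u , sound , complete , refl) (ys , u′ , sound′ , complete′ , refl) =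
  ≤-antisym (unique-⊆-length xs ys u (λ x x∈ → complete′ x (sound x x∈)))
            (unique-⊆-length ys xs u′ (λ x x∈ → complete x (sound′ x x∈)))

HasCard-⇔ : {P Q : A → Set} {k : ℕ} → (∀ x → P x → Q x) → (∀ x → Q x → P x) → HasCard P k → HasCard Q k
HasCard-⇔ P⇒Q Q⇒P (xs , u , sound , complete , len) =
  xs , u , (λ x x∈ → P⇒Q x (sound x x∈)) , (λ x q → complete x (Q⇒P x q)) , len

HasCard-image : {Q : B → Set} (f : A → B) (xs : List A) → Unique xs →
                (∀ x y → x ∈ˡ xs → y ∈ˡ xs → f x ≡ f y → x ≡ y) → (∀ x → x ∈ˡ xs → Q (f x)) →
                (∀ y → Q y → Σ A λ x → x ∈ˡ xs × f x ≡ y) → HasCard Q (length xs)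
HasCard-image {Q = Q} f xs u inj sound onto =
  map f xs , unique-map f xs u inj ,
  (λ y y∈ → let (x , x∈ , y≡fx) = ∈-map⁻ f y∈ in subst Q (sym y≡fx) (sound x x∈)) ,
  (λ y q → let (x , x∈ , fx≡y) = onto y q in subst (_∈ˡ map f xs) fx≡y (∈-map⁺ f x∈)) ,
  List.length-map f xs

length-filter-split : {P : A → Set} (P? : ∀ x → Dec (P x)) (xs : List A) →
                      length xs ≡ length (filter P? xs) + length (filter (∁? P?) xs)
length-filter-split P? [] = refl
length-filter-split P? (x ∷ xs) with does (P? x)
... | true = cong suc (length-filter-split P? xs)
... | false = trans (cong suc (length-filter-split P? xs)) (sym (+-suc _ _))

select : (A → Bool) → List A → List A
select b = filter (λ x → b x Bool.≟ true)

∈-select⁺ : (b : A → Bool) {xs : List A} {x : A} → x ∈ˡ xs → b x ≡ true → x ∈ˡ select b xs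
∈-select⁺ b = ∈-filter⁺ (λ x → b x Bool.≟ true)

∈-select⁻ : (b : A → Bool) (xs : List A) {x : A} → x ∈ˡ select b xs → x ∈ˡ xs × b x ≡ true
∈-select⁻ b xs = ∈-filter⁻ (λ x → b x Bool.≟ true) {xs = xs}

select-unique : (b : A → Bool) {xs : List A} → Unique xs → Unique (select b xs)
select-unique b = Unique.filter⁺ (λ x → b x Bool.≟ true)

sum-indicator : (b : A → Bool) (xs : List A) → sum (map (λ x → if b x then 1 else 0) xs) ≡ length (select b xs)
sum-indicator b [] = refl
sum-indicator b (x ∷ xs) with b x
... | true = cong suc (sum-indicator b xs)
... | false = sum-indicator b xs

sum-guarded : (c : A → Bool) (g : A → ℕ) (xs : List A) →
              sum (map (λ x → if c x then g x else 0) xs) ≡ sum (map g (select c xs))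
sum-guarded c g [] = refl
sum-guarded c g (x ∷ xs) with c x
... | true = cong (g x +_) (sum-guarded c g xs)
... | false = sum-guarded c g xs

sum-double : {A B : Set} (f : A → B → ℕ) (xs : List A) (ys : List B) →
             sum (map (λ x → sum (map (f x) ys)) xs) ≡ sum (map (λ e → f (proj₁ e) (proj₂ e)) (cartesianProduct xs ys))
sum-double f [] ys = refl
sum-double {A} {B} f (x ∷ xs) ys = begin
  sum (map (f x) ys) + sum (map (λ x′ → sum (map (f x′) ys)) xs)  ≡⟨ cong₂ _+_ (cong sum (row ys)) (sum-double f xs ys) ⟩
  sum (map f′ (map (x ,_) ys)) + sum (map f′ (cartesianProduct xs ys))  ≡⟨ sym (sum-++ (map f′ (map (x ,_) ys)) _) ⟩
  sum (map f′ (map (x ,_) ys) ++ map f′ (cartesianProduct xs ys))  ≡⟨ cong sum (sym (List.map-++ f′ (map (x ,_) ys) _)) ⟩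
  sum (map f′ (map (x ,_) ys ++ cartesianProduct xs ys))  ∎
  where
  open ≡-Reasoning
  f′ : A × B → ℕ
  f′ e = f (proj₁ e) (proj₂ e)
  row : ∀ zs → map (f x) zs ≡ map f′ (map (x ,_) zs)
  row [] = refl
  row (z ∷ zs) = cong (f x z ∷_) (row zs)

sum-≤ : (g : A → ℕ) (k : ℕ) (xs : List A) → (∀ x → x ∈ˡ xs → g x ≤ k) → sum (map g xs) ≤ k * length xs
sum-≤ g k [] _ = z≤n
sum-≤ g k (x ∷ xs) bound = subst (sum (map g (x ∷ xs)) ≤_) (sym (*-suc k (length xs)))
  (+-mono-≤ (bound x (here refl)) (sum-≤ g k xs (λ y y∈ → bound y (there y∈))))

sum-< : (g : A → ℕ) (k : ℕ) (xs : List A) → (∀ x → x ∈ˡ xs → g x ≤ k) →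
        ∀ y → y ∈ˡ xs → g y < k → sum (map g xs) < k * length xs
sum-< g k (x ∷ xs) bound y (here refl) gy<k = subst (sum (map g (x ∷ xs)) <_) (sym (*-suc k (length xs)))
  (+-mono-<-≤ gy<k (sum-≤ g k xs (λ z z∈ → bound z (there z∈))))
sum-< g k (x ∷ xs) bound y (there y∈) gy<k = subst (sum (map g (x ∷ xs)) <_) (sym (*-suc k (length xs)))
  (+-mono-≤-< (bound x (here refl)) (sum-< g k xs (λ z z∈ → bound z (there z∈)) y y∈ gy<k))

sum-const : (g : A → ℕ) (k : ℕ) (xs : List A) → (∀ x → x ∈ˡ xs → g x ≡ k) → sum (map g xs) ≡ k * length xs
sum-const g k [] _ = sym (*-zeroʳ k)
sum-const g k (x ∷ xs) eq = trans (cong₂ _+_ (eq x (here refl)) (sum-const g k xs (λ y y∈ → eq y (there y∈))))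
                                  (sym (*-suc k (length xs)))

members : ∀ {n} → Subset n → List (Fin n)
members {zero} [] = []
members {suc n} (inside ∷ p) = zero ∷ map suc (members p)
members {suc n} (outside ∷ p) = map suc (members p)

members-length : ∀ {n} (p : Subset n) → length (members p) ≡ ∣ p ∣
members-length [] = refl
members-length (inside ∷ p) = cong suc (trans (List.length-map suc (members p)) (members-length p))
members-length (outside ∷ p) = trans (List.length-map suc (members p)) (members-length p)

members-unique : ∀ {n} (p : Subset n) → Unique (members p)
members-unique [] = []
members-unique (inside ∷ p) =
  All-map⁺ (All.tabulate λ _ ()) ∷ Unique.map⁺ fsuc-injective (members-unique p)
members-unique (outside ∷ p) = Unique.map⁺ fsuc-injective (members-unique p)

members⁺ : ∀ {n} (p : Subset n) {x} → x ∈ p → x ∈ˡ members p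
members⁺ (inside ∷ p) here = here refl
members⁺ (inside ∷ p) (there x∈p) = there (∈-map⁺ suc (members⁺ p x∈p))
members⁺ (outside ∷ p) (there x∈p) = ∈-map⁺ suc (members⁺ p x∈p)

members⁻ : ∀ {n} (p : Subset n) {x} → x ∈ˡ members p → x ∈ p
members⁻ (inside ∷ p) (here refl) = here
members⁻ (inside ∷ p) (there x∈) with ∈-map⁻ suc x∈
... | _ , y∈ , refl = there (members⁻ p y∈)
members⁻ (outside ∷ p) x∈ with ∈-map⁻ suc x∈
... | _ , y∈ , refl = there (members⁻ p y∈)

∣∣-≤-length : ∀ {n} (p : Subset n) (xs : List (Fin n)) → (∀ x → x ∈ p → x ∈ˡ xs) → ∣ p ∣ ≤ length xs
∣∣-≤-length p xs cover = subst (_≤ length xs) (members-length p)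
  (unique-⊆-length (members p) xs (members-unique p) (λ x x∈ → cover x (members⁻ p x∈)))

length-≤-∣∣ : ∀ {n} (p : Subset n) (xs : List (Fin n)) → Unique xs → (∀ x → x ∈ˡ xs → x ∈ p) → length xs ≤ ∣ p ∣
length-≤-∣∣ p xs u in-p = subst (length xs ≤_) (members-length p)
  (unique-⊆-length xs (members p) u (λ x x∈ → members⁺ p (in-p x x∈)))

three-elements : ∀ {n} (p : Subset n) → 3 ≤ ∣ p ∣ →
  Σ (Fin n) λ x → Σ (Fin n) λ y → Σ (Fin n) λ z → x ≢ y × x ≢ z × y ≢ z × x ∈ p × y ∈ p × z ∈ p
three-elements p 3≤ = pick (members p) (subst (3 ≤_) (sym (members-length p)) 3≤) (members-unique p) (members⁻ p)
  where
  pick : ∀ xs → 3 ≤ length xs → Unique xs → (∀ {x} → x ∈ˡ xs → x ∈ p) →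
         Σ (Fin _) λ x → Σ (Fin _) λ y → Σ (Fin _) λ z → x ≢ y × x ≢ z × y ≢ z × x ∈ p × y ∈ p × z ∈ p
  pick (x ∷ y ∷ z ∷ _) _ ((x≢y ∷ x≢z ∷ _) ∷ (y≢z ∷ _) ∷ _) in-p =
    x , y , z , x≢y , x≢z , y≢z , in-p (here refl) , in-p (there (here refl)) , in-p (there (there (here refl)))
  pick (_ ∷ []) (s≤s ()) _ _
  pick (_ ∷ _ ∷ []) (s≤s (s≤s ())) _ _

two-entries : (xs : List A) → 2 ≤ length xs → Unique xs → Σ A λ x → Σ A λ y → x ∈ˡ xs × y ∈ˡ xs × x ≢ y
two-entries (x ∷ y ∷ _) _ ((x≢y ∷ _) ∷ _) = x , y , here refl , there (here refl) , x≢y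
two-entries (_ ∷ []) (s≤s ()) _

violation-or-all : {P : A → Set} (P? : ∀ x → Dec (P x)) (xs : List A) →
                   (Σ A λ x → x ∈ˡ xs × ¬ P x) ⊎ (∀ x → x ∈ˡ xs → P x)
violation-or-all P? xs with All.all? P? xs
... | yes all = inj₂ (λ x x∈ → All.lookup all x∈)
... | no ¬all = inj₁ (find (¬All⇒Any¬ P? xs ¬all))

unique-reverse : (xs : List A) → Unique xs → Unique (reverse xs)
unique-reverse [] _ = []
unique-reverse (x ∷ xs) (x∉xs ∷ u) =
  subst Unique (sym (List.unfold-reverse x xs))
    (Unique.++⁺ (unique-reverse xs u) ([] ∷ []) λ { (y∈ , here refl) → All.lookup x∉xs (Any-reverse⁻ y∈) refl })

reverse-All : {P : A → Set} {xs : List A} → All P xs → All P (reverse xs)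
reverse-All all = All.tabulate λ z∈ → All.lookup all (Any-reverse⁻ z∈)

argmax : (rank : A → ℕ) (xs : List A) → ∀ {x₀} → x₀ ∈ˡ xs → Σ A λ x → x ∈ˡ xs × (∀ y → y ∈ˡ xs → rank y ≤ rank x)
argmax rank (x ∷ []) _ = x , here refl , λ { y (here refl) → ≤-refl }
argmax rank (x ∷ y ∷ xs) _ with argmax rank (y ∷ xs) (here refl)
... | z , z∈ , z-max with rank x ≤? rank z
... | yes x≤z = z , there z∈ , λ { w (here refl) → x≤z ; w (there w∈) → z-max w w∈ }
... | no x≰z = x , here refl , λ { w (here refl) → ≤-refl ; w (there w∈) → ≤-trans (z-max w w∈) (<⇒≤ (≰⇒> x≰z)) }

<ᵇ-sound : ∀ {a b} → (a <ᵇ b) ≡ true → a < b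
<ᵇ-sound {a} {b} e = <ᵇ⇒< a b (subst T (sym e) tt)

<ᵇ-complete : ∀ {a b} → a < b → (a <ᵇ b) ≡ true
<ᵇ-complete {a} {b} a<b with a <ᵇ b | <⇒<ᵇ a<b
... | true | _ = refl

∈-tabulate⁺ : ∀ {n} (f : Fin n → Bool) x → f x ≡ true → x ∈ tabulate f
∈-tabulate⁺ f x fx = lookup⇒[]= x (tabulate f) (trans (lookup∘tabulate f x) fx)

∈-tabulate⁻ : ∀ {n} (f : Fin n → Bool) x → x ∈ tabulate f → f x ≡ true
∈-tabulate⁻ f x x∈ = trans (sym (lookup∘tabulate f x)) ([]=⇒lookup x∈)

-- Forests on M vertices have at most M − 1 edges

adj⇒≢ : ∀ {n} (G : Graph n) → Irreflexive G → ∀ {x y} → Adj G x y → x ≢ y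
adj⇒≢ G G-irr {x} xy refl with trans (sym (G-irr x)) xy
... | ()

module Forest {M : ℕ} (T : Graph M) (T-sym : Symmetric T) (T-irr : Irreflexive T) (T-acyclic : ¬ HasCycle T) where

  adj-sym : ∀ {x y} → Adj T x y → Adj T y x
  adj-sym {x} {y} xy = trans (sym (T-sym x y)) xy

  data Path : List (Fin M) → Set where
    one  : ∀ y → Path (y ∷ [])
    cons : ∀ {y z ys} → Adj T y z → Path (z ∷ ys) → Path (y ∷ z ∷ ys)

  initial-walk : ∀ {y ys c} → Path (y ∷ ys) → Unique (y ∷ ys) → c ∈ˡ (y ∷ ys) →
                 Σ (List (Fin M)) λ xs → Walk T y c xs × Unique xs × (∀ w → w ∈ˡ xs → w ∈ˡ (y ∷ ys)) × (c ≢ y → 2 ≤ length xs)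
  initial-walk p u (here refl) = _ , stop , [] ∷ [] , (λ { w (here refl) → here refl }) , (λ c≢y → ⊥-elim (c≢y refl))
  initial-walk (cons yz p) (y∉ ∷ u) (there c∈) with initial-walk p u c∈
  ... | xs , wk , u-xs , xs⊆ , _ =
    _ , step yz wk , All.tabulate (λ w∈ → All.lookup y∉ (xs⊆ _ w∈)) ∷ u-xs ,
    (λ { w (here refl) → here refl ; w (there w∈) → there (xs⊆ w w∈) }) , (λ _ → s≤s (length-≥1 wk))
    where
    length-≥1 : ∀ {a b zs} → Walk T a b zs → 1 ≤ length zs
    length-≥1 stop = s≤s z≤n
    length-≥1 (step _ _) = s≤s z≤n

  close-cycle : ∀ {y z ys c} → Path (y ∷ z ∷ ys) → Unique (y ∷ z ∷ ys) → c ∈ˡ (z ∷ ys) → c ≢ z → Adj T c y → HasCycle T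
  close-cycle (cons yz p) (y∉ ∷ u) c∈ c≢z cy with initial-walk p u c∈
  ... | xs , wk , u-xs , xs⊆ , 2≤ =
    _ , _ , _ , step yz wk , All.tabulate (λ w∈ → All.lookup y∉ (xs⊆ _ w∈)) ∷ u-xs , s≤s (2≤ c≢z) , cy

  open import Data.List.Membership.DecPropositional (_≟_ {M}) using () renaming (_∈?_ to _∈ˡ?_)

  -- If every vertex of X has two distinct neighbours in X, then T has a cycle: grow a
  -- duplicate-free path inside X until it must close up (pigeonhole bounds its length).

  module _ (X : List (Fin M))
           (two-nbrs : ∀ x → x ∈ˡ X → Σ (Fin M) λ a → Σ (Fin M) λ b → a ≢ b × Adj T x a × Adj T x b × a ∈ˡ X × b ∈ˡ X) where

    grow : (fuel : ℕ) → ∀ y ys → Path (y ∷ ys) → Unique (y ∷ ys) → All (_∈ˡ X) (y ∷ ys) →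
           length (y ∷ ys) + fuel ≡ suc (length X) → HasCycle T
    grow zero y ys _ u in-X len = ⊥-elim (<-irrefl refl (subst (_≤ length X) (trans (sym (+-identityʳ _)) len)
                                        (unique-⊆-length (y ∷ ys) X u (λ w w∈ → All.lookup in-X w∈))))
    grow (suc fuel) y ys p u in-X len with two-nbrs y (All.lookup in-X (here refl))
    grow (suc fuel) y [] p u in-X len | a , _ , _ , ya , _ , a∈X , _ =
      grow fuel a (y ∷ []) (cons (adj-sym ya) p) ((adj⇒≢ T T-irr (adj-sym ya) ∷ []) ∷ u) (a∈X ∷ in-X) (trans (sym (+-suc _ fuel)) len)
    grow (suc fuel) y (z ∷ zs) p u in-X len | a , b , a≢b , ya , yb , a∈X , b∈X = extend (choose (a ≟ z))
      where
      Continuation : Set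
      Continuation = Σ (Fin M) λ c → Adj T y c × c ∈ˡ X × c ≢ z
      choose : Dec (a ≡ z) → Continuation
      choose (yes refl) = b , yb , b∈X , (λ b≡a → a≢b (sym b≡a))
      choose (no a≢z) = a , ya , a∈X , a≢z
      extend : Continuation → HasCycle T
      extend (c , yc , c∈X , c≢z) with c ∈ˡ? (y ∷ z ∷ zs)
      ... | yes (here refl) = ⊥-elim (adj⇒≢ T T-irr yc refl)
      ... | yes (there c∈) = close-cycle p u c∈ c≢z (adj-sym yc)
      ... | no c∉ = grow fuel c (y ∷ z ∷ zs) (cons (adj-sym yc) p) (¬Any⇒All¬ _ c∉ ∷ u) (c∈X ∷ in-X)
                      (trans (sym (+-suc _ fuel)) len)

    min-degree-2⇒cycle : ∀ {x} → x ∈ˡ X → HasCycle T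
    min-degree-2⇒cycle {x} x∈X = grow (length X) x [] (one x) ([] ∷ []) (x∈X ∷ []) refl

  Edge : Set
  Edge = Fin M × Fin M

  EdgeIn : List (Fin M) → Edge → Set
  EdgeIn X (i , j) = toℕ i < toℕ j × Adj T i j × i ∈ˡ X × j ∈ˡ X

  Incident : Fin M → Edge → Set
  Incident x (i , j) = i ≡ x ⊎ j ≡ x

  incident? : ∀ x e → Dec (Incident x e)
  incident? x (i , j) = (i ≟ x) ⊎-dec (j ≟ x)

  other-end : ∀ X x e → EdgeIn X e → Incident x e → Σ (Fin M) λ a → Adj T x a × a ∈ˡ X × (e ≡ (x , a) ⊎ e ≡ (a , x))
  other-end X x (i , j) (_ , ij , i∈X , j∈X) (inj₁ refl) = j , ij , j∈X , inj₁ refl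
  other-end X x (i , j) (_ , ij , i∈X , j∈X) (inj₂ refl) = i , adj-sym ij , i∈X , inj₂ refl

  two-neighbours : ∀ X (L : List Edge) → (∀ e → e ∈ˡ L → EdgeIn X e) → ∀ x → 2 ≤ length (filter (incident? x) L) → Unique L →
                   Σ (Fin M) λ a → Σ (Fin M) λ b → a ≢ b × Adj T x a × Adj T x b × a ∈ˡ X × b ∈ˡ X
  two-neighbours X L edges x 2≤ u with two-entries (filter (incident? x) L) 2≤ (Unique.filter⁺ (incident? x) u)
  ... | e₁ , e₂ , e₁∈ , e₂∈ , e₁≢e₂ with ∈-filter⁻ (incident? x) e₁∈ | ∈-filter⁻ (incident? x) e₂∈
  ... | e₁∈L , x∈e₁ | e₂∈L , x∈e₂ with other-end X x e₁ (edges e₁ e₁∈L) x∈e₁ | other-end X x e₂ (edges e₂ e₂∈L) x∈e₂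
  ... | a , xa , a∈X , ≡e₁ | b , xb , b∈X , ≡e₂ = a , b , a≢b ≡e₁ ≡e₂ , xa , xb , a∈X , b∈X
    where
    a≢b : (e₁ ≡ (x , a) ⊎ e₁ ≡ (a , x)) → (e₂ ≡ (x , b) ⊎ e₂ ≡ (b , x)) → a ≢ b
    a≢b (inj₁ refl) (inj₁ refl) refl = e₁≢e₂ refl
    a≢b (inj₂ refl) (inj₂ refl) refl = e₁≢e₂ refl
    a≢b (inj₁ refl) (inj₂ refl) refl = <-asym (proj₁ (edges e₁ e₁∈L)) (proj₁ (edges e₂ e₂∈L))
    a≢b (inj₂ refl) (inj₁ refl) refl = <-asym (proj₁ (edges e₁ e₁∈L)) (proj₁ (edges e₂ e₂∈L))

  -- Edge bound, by removing a vertex of degree ≤ 1 (which exists, T being acyclic).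
  forest-edges : ∀ k (X : List (Fin M)) → length X ≡ suc k → Unique X →
                 (L : List Edge) → Unique L → (∀ e → e ∈ˡ L → EdgeIn X e) → length L ≤ k
  forest-edges zero (x ∷ []) refl _ [] _ _ = z≤n
  forest-edges zero (x ∷ []) refl _ (e ∷ L) _ edges with edges e (here refl)
  ... | i<j , _ , here refl , here refl = ⊥-elim (<-irrefl refl i<j)
  forest-edges (suc k) X len u L u-L edges with violation-or-all (λ x → 2 ≤? length (filter (incident? x) L)) X
  ... | inj₂ all-≥2 = ⊥-elim (T-acyclic (min-degree-2⇒cycle X
          (λ x x∈ → two-neighbours X L edges x (all-≥2 x x∈) u-L) (proj₂ (nonempty X len))))
    where
    nonempty : ∀ Y → length Y ≡ suc (suc k) → Σ (Fin M) (_∈ˡ Y)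
    nonempty (y ∷ _) _ = y , here refl
  ... | inj₁ (x , x∈X , ¬2≤) = begin
      length L
        ≡⟨ length-filter-split (incident? x) L ⟩
      length (filter (incident? x) L) + length (filter (∁? (incident? x)) L)
        ≤⟨ +-mono-≤ (≤-pred (≰⇒> ¬2≤)) (forest-edges k (remove X x∈X) (suc-injective (trans (sym (length-remove X x∈X)) len))
                        (remove-unique X x∈X u) (filter (∁? (incident? x)) L) (Unique.filter⁺ _ u-L) edges′) ⟩
      1 + k ∎
    where
    open ≤-Reasoning
    edges′ : ∀ e → e ∈ˡ filter (∁? (incident? x)) L → EdgeIn (remove X x∈X) e
    edges′ (i , j) e∈ with ∈-filter⁻ (∁? (incident? x)) e∈
    ... | e∈L , x∉e with edges (i , j) e∈L
    ... | i<j , ij , i∈X , j∈X =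
      i<j , ij , ∈-remove X x∈X i∈X (λ i≡x → x∉e (inj₁ i≡x)) , ∈-remove X x∈X j∈X (λ j≡x → x∉e (inj₂ j≡x))

module _ {n : ℕ} {G : Graph n} where

  walk-start : ∀ {x y zs} → Walk G x y zs → x ∈ˡ zs
  walk-start stop = here refl
  walk-start (step _ _) = here refl

  walk-end : ∀ {x y zs} → Walk G x y zs → y ∈ˡ zs
  walk-end stop = here refl
  walk-end (step _ wk) = there (walk-end wk)

  walk-snoc : ∀ {u v w xs} → Walk G u v xs → Adj G v w → Walk G u w (xs ++ w ∷ [])
  walk-snoc stop vw = step vw stop
  walk-snoc (step a wk) vw = step a (walk-snoc wk vw)

  walk-reverse : Symmetric G → ∀ {u v xs} → Walk G u v xs → Walk G v u (reverse xs)
  walk-reverse G-sym stop = stop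
  walk-reverse G-sym (step {u} {w} {xs = xs} uw wk) =
    subst (Walk G _ u) (sym (List.unfold-reverse u xs)) (walk-snoc (walk-reverse G-sym wk) (trans (G-sym w u) uw))

  walk-append : ∀ {u v w xs ys} → Walk G u v xs → Walk G v w ys →
                Σ (List (Fin n)) λ zs → Walk G u w zs × (∀ z → z ∈ˡ zs → z ∈ˡ xs ⊎ z ∈ˡ ys)
  walk-append stop wk₂ = _ , wk₂ , λ z z∈ → inj₂ z∈
  walk-append (step a wk₁) wk₂ with walk-append wk₁ wk₂
  ... | zs , wk , origin = _ , step a wk , λ { z (here refl) → inj₁ (here refl) ; z (there z∈) → Data.Sum.map₁ there (origin z z∈) }

  walk-append-All : ∀ {P : Fin n → Set} {u v w xs ys} → Walk G u v xs → Walk G v w ys → All P xs → All P ys →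
                    Σ (List (Fin n)) λ zs → Walk G u w zs × All P zs
  walk-append-All wk₁ wk₂ all₁ all₂ with walk-append wk₁ wk₂
  ... | zs , wk , origin = zs , wk , All.tabulate λ {z} z∈ → [ All.lookup all₁ , All.lookup all₂ ] (origin z z∈)

-- Trees given by parent pointers

module ParentTree {M : ℕ} (rank : Fin M → ℕ) (root : Fin M) (par : Fin M → Fin M)
                  (par-< : ∀ i → i ≢ root → rank (par i) < rank i) where

  Up : Fin M → Fin M → Set
  Up x y = x ≢ root × y ≡ par x

  up? : Fin M → Fin M → Bool
  up? x y = not (does (x ≟ root)) ∧ does (y ≟ par x)

  T* : Graph M
  T* x y = up? x y ∨ up? y x

  up?-sound : ∀ x y → up? x y ≡ true → Up x y
  up?-sound x y e with x ≟ root | y ≟ par x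
  up?-sound x y e | no x≢r | yes y≡p = x≢r , y≡p
  up?-sound x y () | yes _ | _
  up?-sound x y () | no _ | no _

  up?-complete : ∀ x y → Up x y → up? x y ≡ true
  up?-complete x y (x≢r , refl) rewrite dec-false (x ≟ root) x≢r | dec-true (par x ≟ par x) refl = refl

  T*-adj⁻ : ∀ {x y} → Adj T* x y → Up x y ⊎ Up y x
  T*-adj⁻ {x} {y} xy with up? x y in e
  ... | true = inj₁ (up?-sound x y e)
  ... | false = inj₂ (up?-sound y x xy)

  T*-adj⁺ : ∀ {x y} → Up x y ⊎ Up y x → Adj T* x y
  T*-adj⁺ {x} {y} (inj₁ up) rewrite up?-complete x y up = refl
  T*-adj⁺ {x} {y} (inj₂ up) rewrite up?-complete y x up = ∨-zeroʳ (up? x y)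

  par-≢ : ∀ i → i ≢ root → par i ≢ i
  par-≢ i i≢r e = <-irrefl (cong rank e) (par-< i i≢r)

  T*-sym : Symmetric T*
  T*-sym x y = ∨-comm (up? x y) (up? y x)

  T*-irr : Irreflexive T*
  T*-irr x with T* x x in e
  ... | false = refl
  ... | true with T*-adj⁻ {x} {x} e
  ... | inj₁ (x≢r , x≡p) = ⊥-elim (par-≢ x x≢r (sym x≡p))
  ... | inj₂ (x≢r , x≡p) = ⊥-elim (par-≢ x x≢r (sym x≡p))

  walk-to-root : (fuel : ℕ) → ∀ j → rank j < fuel → ∃[ xs ] Walk T* j root xs
  walk-to-root (suc fuel) j j<fuel with j ≟ root
  ... | yes refl = _ , stop
  ... | no j≢r with walk-to-root fuel (par j) (≤-trans (par-< j j≢r) (≤-pred j<fuel))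
  ... | xs , wk = _ , step (T*-adj⁺ (inj₁ (j≢r , refl))) wk

  -- Any two vertices are joined through the root.
  T*-connected : Connected T*
  T*-connected u v =
    let (_ , u→r) = walk-to-root (suc (rank u)) u ≤-refl
        (_ , v→r) = walk-to-root (suc (rank v)) v ≤-refl
        (zs , wk , _) = walk-append u→r (walk-reverse T*-sym v→r)
    in zs , wk

  rank-climbs : ∀ {u c w ys} → Walk T* c w ys → Unique (u ∷ ys) → Up c u → rank u < rank w
  rank-climbs stop _ (c≢r , refl) = par-< _ c≢r
  rank-climbs {u} (step cd wk) (u∉ ∷ u-ys) (c≢r , refl) with T*-adj⁻ cd
  ... | inj₁ (_ , d≡u) = ⊥-elim (All.lookup u∉ (there (walk-start wk)) (sym d≡u))
  ... | inj₂ d-below-c = <-trans (par-< _ c≢r) (rank-climbs wk u-ys d-below-c)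

  no-long-walk-to-parent : ∀ {a b zs} → Walk T* a b zs → Unique zs → 3 ≤ length zs → Up a b → ⊥
  no-long-walk-to-parent (step ac (step cd wk)) (a∉ ∷ u) _ (a≢r , refl) with T*-adj⁻ ac
  ... | inj₁ (_ , c≡b) = All.lookup (proj₁ (uncons u)) (walk-end wk) c≡b
    where uncons : ∀ {x xs} → Unique (x ∷ xs) → All (x ≢_) xs × Unique xs
          uncons (x∉ ∷ u′) = x∉ , u′
  ... | inj₂ c-below-a = <-asym (rank-climbs (step cd wk) (a∉ ∷ u) c-below-a) (par-< _ a≢r)
  no-long-walk-to-parent stop _ (s≤s ()) _
  no-long-walk-to-parent (step _ stop) _ (s≤s (s≤s ())) _

  -- A cycle contains an edge between a vertex and its parent, closed by a long walk.
  T*-acyclic : ¬ HasCycle T*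
  T*-acyclic (u , w , xs , wk , u-xs , 3≤ , wu) with T*-adj⁻ wu
  ... | inj₂ w-parent = no-long-walk-to-parent wk u-xs 3≤ w-parent
  ... | inj₁ u-parent = no-long-walk-to-parent (walk-reverse T*-sym wk) (unique-reverse xs u-xs)
                          (subst (3 ≤_) (sym (List.length-reverse xs)) 3≤) u-parent

  T*-tree : IsTree T*
  T*-tree = T*-connected , T*-acyclic

  -- Desc c j: j lies in the subtree rooted at c (c is reached from j via parents).
  data Desc (c : Fin M) : Fin M → Set where
    dhere : Desc c c
    dup : ∀ {j} → j ≢ root → Desc c (par j) → Desc c j

  desc-rank : ∀ {c j} → Desc c j → rank c ≤ rank j
  desc-rank dhere = ≤-refl
  desc-rank (dup j≢r d) = <⇒≤ (≤-<-trans (desc-rank d) (par-< _ j≢r))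

  desc-inv : ∀ {c j} → Desc c j → c ≢ j → j ≢ root × Desc c (par j)
  desc-inv dhere c≢j = ⊥-elim (c≢j refl)
  desc-inv (dup j≢r d) _ = j≢r , d

  desc-≢root : ∀ {c j} → Desc c j → c ≢ j → j ≢ root
  desc-≢root d c≢j = proj₁ (desc-inv d c≢j)

  desc-< : ∀ {c j} → Desc c j → c ≢ j → rank c < rank j
  desc-< d c≢j with desc-inv d c≢j
  ... | j≢r , d′ = ≤-<-trans (desc-rank d′) (par-< _ j≢r)

  desc-trans : ∀ {a b c} → Desc a b → Desc b c → Desc a c
  desc-trans d dhere = d
  desc-trans d (dup c≢r e) = dup c≢r (desc-trans d e)

  desc? : ∀ c j → Dec (Desc c j)
  desc? c j = search (suc (rank j)) j ≤-refl
    where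
    search : (fuel : ℕ) → ∀ j → rank j < fuel → Dec (Desc c j)
    search (suc fuel) j j<fuel with c ≟ j
    ... | yes refl = yes dhere
    ... | no c≢j with j ≟ root
    ... | yes refl = no λ d → proj₁ (desc-inv d c≢j) refl
    ... | no j≢r with search fuel (par j) (≤-trans (par-< j j≢r) (≤-pred j<fuel))
    ... | yes d = yes (dup j≢r d)
    ... | no ¬d = no λ d → ¬d (proj₂ (desc-inv d c≢j))

  root-desc : ∀ j → Desc root j
  root-desc j = climb (suc (rank j)) j ≤-refl
    where
    climb : (fuel : ℕ) → ∀ j → rank j < fuel → Desc root j
    climb (suc fuel) j j<fuel with j ≟ root
    ... | yes refl = dhere
    ... | no j≢r = dup j≢r (climb fuel (par j) (≤-trans (par-< j j≢r) (≤-pred j<fuel)))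

  ¬desc⇒≢root : ∀ {q z} → ¬ Desc q z → q ≢ root
  ¬desc⇒≢root ¬d refl = ¬d (root-desc _)

  not-desc-par : ∀ {i} → i ≢ root → ¬ Desc i (par i)
  not-desc-par i≢r d = <-irrefl refl (≤-<-trans (desc-rank d) (par-< _ i≢r))

  child-towards : ∀ {q z} → Desc q z → q ≢ z → Σ (Fin M) λ c → c ≢ root × par c ≡ q × Desc c z
  child-towards dhere q≢z = ⊥-elim (q≢z refl)
  child-towards {q} (dup {j} j≢r d) q≢z with q ≟ par j
  ... | yes refl = j , j≢r , refl , dhere
  ... | no q≢pj with child-towards d q≢pj
  ... | c , c≢r , pc≡q , dc = c , c≢r , pc≡q , dup j≢r dc

  cut-subtree : ∀ (T′ : Graph M) → (∀ x y → Adj T′ x y → Adj T* x y) → ∀ i → i ≢ root → ¬ Adj T′ i (par i) →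
                ∀ {x y xs} → Walk T′ x y xs → Desc i x → Desc i y
  cut-subtree T′ T′⊆T* i i≢r no-edge stop d = d
  cut-subtree T′ T′⊆T* i i≢r no-edge (step {x} xz wk) d with T*-adj⁻ (T′⊆T* _ _ xz)
  ... | inj₂ (z≢r , x≡pz) = cut-subtree T′ T′⊆T* i i≢r no-edge wk (dup z≢r (subst (Desc i) x≡pz d))
  ... | inj₁ (x≢r , z≡px) with i ≟ x
  ... | yes refl = ⊥-elim (no-edge (subst (Adj T′ i) z≡px xz))
  ... | no i≢x = cut-subtree T′ T′⊆T* i i≢r no-edge wk (subst (Desc i) (sym z≡px) (proj₂ (desc-inv d i≢x)))

  EdgeOf : Graph M → Fin M × Fin M → Set
  EdgeOf T′ (i , j) = (toℕ i <ᵇ toℕ j) ≡ true × Adj T′ i j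

  parent-edge : Fin M → Fin M × Fin M
  parent-edge q = if toℕ (par q) <ᵇ toℕ q then (par q , q) else (q , par q)

  parent-edge-below : ∀ q → toℕ q < toℕ (par q) → parent-edge q ≡ (q , par q)
  parent-edge-below q q<pq with toℕ (par q) <ᵇ toℕ q in e
  ... | false = refl
  ... | true = ⊥-elim (<-asym q<pq (<ᵇ-sound e))

  parent-edge-above : ∀ q → toℕ (par q) < toℕ q → parent-edge q ≡ (par q , q)
  parent-edge-above q pq<q rewrite <ᵇ-complete pq<q = refl

  parent-edge-is-edge : ∀ q → q ≢ root → EdgeOf T* (parent-edge q)
  parent-edge-is-edge q q≢r with toℕ (par q) <ᵇ toℕ q in e
  ... | true = e , T*-adj⁺ (inj₂ (q≢r , refl))
  ... | false = <ᵇ-complete q<pq , T*-adj⁺ (inj₁ (q≢r , refl))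
    where
    q<pq : toℕ q < toℕ (par q)
    q<pq = ≤∧≢⇒< (≮⇒≥ (λ pq<q → case-false (trans (sym e) (<ᵇ-complete pq<q))))
                  (λ q≡pq → par-≢ q q≢r (sym (toℕ-injective q≡pq)))
      where case-false : false ≡ true → ⊥
            case-false ()

  edge-is-parent-edge : ∀ e → EdgeOf T* e → Σ (Fin M) λ q → q ≢ root × parent-edge q ≡ e
  edge-is-parent-edge (i , j) (i<j , ij) with T*-adj⁻ {i} {j} ij
  ... | inj₁ (i≢r , refl) = i , i≢r , parent-edge-below i (<ᵇ-sound i<j)
  ... | inj₂ (j≢r , refl) = j , j≢r , parent-edge-above j (<ᵇ-sound i<j)

  parent-edge-injective : ∀ q q′ → q ≢ root → q′ ≢ root → parent-edge q ≡ parent-edge q′ → q ≡ q′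
  parent-edge-injective q q′ q≢r q′≢r e with toℕ (par q) <ᵇ toℕ q | toℕ (par q′) <ᵇ toℕ q′
  parent-edge-injective q q′ q≢r q′≢r refl | true | true = refl
  parent-edge-injective q q′ q≢r q′≢r refl | false | false = refl
  parent-edge-injective q q′ q≢r q′≢r e | true | false =
    ⊥-elim (<-asym (subst (λ t → rank t < rank q) (cong proj₁ e) (par-< q q≢r))
                   (subst (λ t → rank t < rank q′) (sym (cong proj₂ e)) (par-< q′ q′≢r)))
  parent-edge-injective q q′ q≢r q′≢r e | false | true =
    ⊥-elim (<-asym (subst (λ t → rank t < rank q′) (sym (cong proj₁ e)) (par-< q′ q′≢r))
                   (subst (λ t → rank t < rank q) (cong proj₂ e) (par-< q q≢r)))

  non-roots : List (Fin M)
  non-roots = filter (∁? (_≟ root)) (allFin M)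

  non-roots-unique : Unique non-roots
  non-roots-unique = Unique.filter⁺ (∁? (_≟ root)) {allFin M} (Unique.allFin⁺ M)

  ∈-non-roots⁺ : ∀ q → q ≢ root → q ∈ˡ non-roots
  ∈-non-roots⁺ q q≢r = ∈-filter⁺ (∁? (_≟ root)) (∈-allFin q) q≢r

  ∈-non-roots⁻ : ∀ {q} → q ∈ˡ non-roots → q ≢ root
  ∈-non-roots⁻ q∈ = proj₂ (∈-filter⁻ (∁? (_≟ root)) {xs = allFin M} q∈)

  non-roots-length : length non-roots ≡ M ∸ 1
  non-roots-length = sym (cong (_∸ 1) (begin
    M                                                   ≡⟨ sym (List.length-tabulate {n = M} (λ i → i)) ⟩
    length (allFin M)                                   ≡⟨ length-filter-split (_≟ root) (allFin M) ⟩
    length (filter (_≟ root) (allFin M)) + length non-roots ≡⟨ cong (_+ length non-roots) only-root ⟩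
    suc (length non-roots)                              ∎))
    where
    open ≡-Reasoning
    only-root : length (filter (_≟ root) (allFin M)) ≡ 1
    only-root = ≤-antisym
      (unique-⊆-length _ (root ∷ []) (Unique.filter⁺ (_≟ root) {allFin M} (Unique.allFin⁺ M))
         (λ x x∈ → here (proj₂ (∈-filter⁻ (_≟ root) {xs = allFin M} x∈))))
      (unique-⊆-length (root ∷ []) _ ([] ∷ []) (λ { x (here refl) → ∈-filter⁺ (_≟ root) (∈-allFin root) refl }))

  -- T* has exactly M − 1 edges, one from each non-root vertex to its parent.
  T*-edge-count : HasCard (EdgeOf T*) (M ∸ 1)
  T*-edge-count = subst (HasCard (EdgeOf T*)) non-roots-length
    (HasCard-image parent-edge non-roots non-roots-unique
      (λ q q′ q∈ q′∈ → parent-edge-injective q q′ (∈-non-roots⁻ q∈) (∈-non-roots⁻ q′∈))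
      (λ q q∈ → parent-edge-is-edge q (∈-non-roots⁻ q∈))
      (λ e e-edge → let (q , q≢r , eq) = edge-is-parent-edge e e-edge in q , ∈-non-roots⁺ q q≢r , eq))

-- Apollonian clique structures

quad : ∀ {n M} → (ν fa fb fc : Fin M → Fin n) → Fin M → List (Fin n)
quad ν fa fb fc i = ν i ∷ fa i ∷ fb i ∷ fc i ∷ []

-- The family Q : Fin M → Subset n lists the cliques of G produced by the RAN construction,
-- together with the construction tree (par, root, rank) relating them.
record CliqueStructure {n : ℕ} (G : Graph n) (M : ℕ) (Q : Fin M → Subset n) : Set where
  field
    rank : Fin M → ℕ
    root : Fin M
    par : Fin M → Fin M
    par-< : ∀ i → i ≢ root → rank (par i) < rank i
    ν fa fb fc : Fin M → Fin n
    distinct : ∀ i → Unique (quad ν fa fb fc i)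
    quad⊆Q : ∀ i x → x ∈ˡ quad ν fa fb fc i → x ∈ Q i
    Q⊆quad : ∀ i x → x ∈ Q i → x ∈ˡ quad ν fa fb fc i
    face-in-par : ∀ i → i ≢ root → fa i ∈ Q (par i) × fb i ∈ Q (par i) × fc i ∈ Q (par i)
    new-in-subtree : ∀ i z → ν i ∈ Q z → ParentTree.Desc rank root par par-< i z
    Q-clique : ∀ i → IsClique G (Q i)
    cover : ∀ C → IsClique G C → ∃[ i ] C ⊆ Q i
    share3 : ∀ i j x y z → x ≢ y → x ≢ z → y ≢ z → x ∈ Q i → y ∈ Q i → z ∈ Q i →
             x ∈ Q j → y ∈ Q j → z ∈ Q j → i ≢ j → (j ≢ root × i ≡ par j) ⊎ (i ≢ root × j ≡ par i)
    G-sym : Symmetric G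

module Relabel {n M : ℕ} {E G : Graph n} {Q : Fin M → Subset n} (S : CliqueStructure E M Q)
               (s s⁻¹ : Fin n → Fin n) (s∘s⁻¹ : ∀ x → s (s⁻¹ x) ≡ x) (s⁻¹∘s : ∀ u → s⁻¹ (s u) ≡ u)
               (G≡E : ∀ x y → G x y ≡ E (s⁻¹ x) (s⁻¹ y)) where
  open CliqueStructure S

  Q′ : Fin M → Subset n
  Q′ i = tabulate (λ x → does (s⁻¹ x ∈? Q i))

  ∈Q′⁺ : ∀ i x → s⁻¹ x ∈ Q i → x ∈ Q′ i
  ∈Q′⁺ i x m = ∈-tabulate⁺ _ x (dec-true (s⁻¹ x ∈? Q i) m)

  ∈Q′⁻ : ∀ i x → x ∈ Q′ i → s⁻¹ x ∈ Q i
  ∈Q′⁻ i x m = does-true (s⁻¹ x ∈? Q i) (∈-tabulate⁻ _ x m)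

  image∈Q′ : ∀ i u → u ∈ Q i → s u ∈ Q′ i
  image∈Q′ i u m = ∈Q′⁺ i (s u) (subst (_∈ Q i) (sym (s⁻¹∘s u)) m)

  s-injective : ∀ {x y} → s x ≡ s y → x ≡ y
  s-injective {x} {y} e = trans (sym (s⁻¹∘s x)) (trans (cong s⁻¹ e) (s⁻¹∘s y))

  s⁻¹-≢ : ∀ {x y} → x ≢ y → s⁻¹ x ≢ s⁻¹ y
  s⁻¹-≢ x≢y e = x≢y (trans (sym (s∘s⁻¹ _)) (trans (cong s e) (s∘s⁻¹ _)))

  relabelled : CliqueStructure G M Q′
  relabelled = record
    { rank = rank ; root = root ; par = par ; par-< = par-<
    ; ν = λ i → s (ν i) ; fa = λ i → s (fa i) ; fb = λ i → s (fb i) ; fc = λ i → s (fc i)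
    ; distinct = λ i → Unique.map⁺ s-injective (distinct i)
    ; quad⊆Q = λ i x m → let (v , v∈ , x≡sv) = ∈-map⁻ s m
                         in ∈Q′⁺ i x (subst (_∈ Q i) (trans (sym (s⁻¹∘s v)) (cong s⁻¹ (sym x≡sv))) (quad⊆Q i v v∈))
    ; Q⊆quad = λ i x m → subst (_∈ˡ map s (quad ν fa fb fc i)) (s∘s⁻¹ x) (∈-map⁺ s (Q⊆quad i (s⁻¹ x) (∈Q′⁻ i x m)))
    ; face-in-par = λ i i≢r → let (a , b , c) = face-in-par i i≢r in image∈Q′ _ _ a , image∈Q′ _ _ b , image∈Q′ _ _ c
    ; new-in-subtree = λ i z m → new-in-subtree i z (subst (_∈ Q z) (s⁻¹∘s (ν i)) (∈Q′⁻ z _ m))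
    ; Q-clique = λ i x y x∈ y∈ x≢y → trans (G≡E x y) (Q-clique i (s⁻¹ x) (s⁻¹ y) (∈Q′⁻ i x x∈) (∈Q′⁻ i y y∈) (s⁻¹-≢ x≢y))
    ; cover = cover′
    ; share3 = λ i j x y z x≢y x≢z y≢z xi yi zi xj yj zj →
        share3 i j (s⁻¹ x) (s⁻¹ y) (s⁻¹ z) (s⁻¹-≢ x≢y) (s⁻¹-≢ x≢z) (s⁻¹-≢ y≢z)
               (∈Q′⁻ i x xi) (∈Q′⁻ i y yi) (∈Q′⁻ i z zi) (∈Q′⁻ j x xj) (∈Q′⁻ j y yj) (∈Q′⁻ j z zj)
    ; G-sym = λ x y → trans (G≡E x y) (trans (G-sym (s⁻¹ x) (s⁻¹ y)) (sym (G≡E y x))) }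
    where
    -- a clique C of G is the image of the clique s⁻¹(C) of E
    cover′ : ∀ C → IsClique G C → ∃[ i ] C ⊆ Q′ i
    cover′ C C-clique with cover (tabulate (λ u → does (s u ∈? C))) preimage-clique
      where
      in-C : ∀ u → u ∈ tabulate (λ u → does (s u ∈? C)) → s u ∈ C
      in-C u m = does-true (s u ∈? C) (∈-tabulate⁻ _ u m)
      preimage-clique : IsClique E (tabulate (λ u → does (s u ∈? C)))
      preimage-clique u v u∈ v∈ u≢v =
        trans (cong₂ E (sym (s⁻¹∘s u)) (sym (s⁻¹∘s v)))
              (trans (sym (G≡E (s u) (s v))) (C-clique (s u) (s v) (in-C u u∈) (in-C v v∈) (λ e → u≢v (s-injective e))))
    ... | i , sub = i , λ {x} x∈C →
      ∈Q′⁺ i x (sub (∈-tabulate⁺ _ (s⁻¹ x) (dec-true (s (s⁻¹ x) ∈? C) (subst (_∈ C) (sym (s∘s⁻¹ x)) x∈C))))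

module Reindex {n M M′ : ℕ} {G : Graph n} {Q : Fin M → Subset n} (S : CliqueStructure G M Q)
               (Q′ : Fin M′ → Subset n) (π : Fin M′ → Fin M) (ρ : Fin M → Fin M′)
               (π∘ρ : ∀ i → π (ρ i) ≡ i) (ρ∘π : ∀ q → ρ (π q) ≡ q) (Q′≡ : ∀ q → Q′ q ≡ Q (π q)) where
  open CliqueStructure S
  module Old = ParentTree rank root par par-<

  root′ : Fin M′
  root′ = ρ root

  par′ : Fin M′ → Fin M′
  par′ q = ρ (par (π q))

  π-≢root : ∀ {q} → q ≢ root′ → π q ≢ root
  π-≢root {q} q≢r e = q≢r (trans (sym (ρ∘π q)) (cong ρ e))

  ρ-≢root : ∀ {i} → i ≢ root → ρ i ≢ root′
  ρ-≢root {i} i≢r e = i≢r (trans (sym (π∘ρ i)) (trans (cong π e) (π∘ρ root)))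

  par′-< : ∀ q → q ≢ root′ → rank (π (par′ q)) < rank (π q)
  par′-< q q≢r = subst (λ t → rank t < rank (π q)) (sym (π∘ρ (par (π q)))) (par-< (π q) (π-≢root q≢r))

  module New = ParentTree (λ q → rank (π q)) root′ par′ par′-<

  desc′ : ∀ {i z} → Old.Desc i z → New.Desc (ρ i) (ρ z)
  desc′ Old.dhere = New.dhere
  desc′ (Old.dup {j} j≢r d) = New.dup (ρ-≢root j≢r) (subst (λ t → New.Desc _ (ρ (par t))) (sym (π∘ρ j)) (desc′ d))

  ∈Q′⁺ : ∀ {x} q → x ∈ Q (π q) → x ∈ Q′ q
  ∈Q′⁺ q m = subst (_ ∈_) (sym (Q′≡ q)) m

  ∈Q′⁻ : ∀ {x} q → x ∈ Q′ q → x ∈ Q (π q)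
  ∈Q′⁻ q m = subst (_ ∈_) (Q′≡ q) m

  ∈Q′-ρ : ∀ {x} i → x ∈ Q i → x ∈ Q′ (ρ i)
  ∈Q′-ρ i m = ∈Q′⁺ (ρ i) (subst (λ t → _ ∈ Q t) (sym (π∘ρ i)) m)

  reindexed : CliqueStructure G M′ Q′
  reindexed = record
    { rank = λ q → rank (π q) ; root = root′ ; par = par′ ; par-< = par′-<
    ; ν = λ q → ν (π q) ; fa = λ q → fa (π q) ; fb = λ q → fb (π q) ; fc = λ q → fc (π q)
    ; distinct = λ q → distinct (π q)
    ; quad⊆Q = λ q x m → ∈Q′⁺ q (quad⊆Q (π q) x m)
    ; Q⊆quad = λ q x m → Q⊆quad (π q) x (∈Q′⁻ q m)
    ; face-in-par = λ q q≢r → let (a , b , c) = face-in-par (π q) (π-≢root q≢r) in ∈Q′-ρ _ a , ∈Q′-ρ _ b , ∈Q′-ρ _ c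
    ; new-in-subtree = λ q z m → subst₂ New.Desc (ρ∘π q) (ρ∘π z) (desc′ (new-in-subtree (π q) (π z) (∈Q′⁻ z m)))
    ; Q-clique = λ q x y x∈ y∈ x≢y → Q-clique (π q) x y (∈Q′⁻ q x∈) (∈Q′⁻ q y∈) x≢y
    ; cover = λ C C-clique → let (i , sub) = cover C C-clique in ρ i , λ m → ∈Q′-ρ i (sub m)
    ; share3 = λ q r x y z x≢y x≢z y≢z xq yq zq xr yr zr q≢r →
        back q r (share3 (π q) (π r) x y z x≢y x≢z y≢z (∈Q′⁻ q xq) (∈Q′⁻ q yq) (∈Q′⁻ q zq)
                         (∈Q′⁻ r xr) (∈Q′⁻ r yr) (∈Q′⁻ r zr) (λ e → q≢r (trans (sym (ρ∘π q)) (trans (cong ρ e) (ρ∘π r)))))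
    ; G-sym = G-sym }
    where
    back : ∀ q r → (π r ≢ root × π q ≡ par (π r)) ⊎ (π q ≢ root × π r ≡ par (π q)) →
           (r ≢ root′ × q ≡ par′ r) ⊎ (q ≢ root′ × r ≡ par′ q)
    back q r (inj₁ (r≢r , e)) = inj₁ ((λ e′ → r≢r (trans (cong π e′) (π∘ρ root))) , trans (sym (ρ∘π q)) (cong ρ e))
    back q r (inj₂ (q≢r , e)) = inj₂ ((λ e′ → q≢r (trans (cong π e′) (π∘ρ root))) , trans (sym (ρ∘π r)) (cong ρ e))

module Cliques {n M : ℕ} {G : Graph n} {Q : Fin M → Subset n} (S : CliqueStructure G M Q) where
  open CliqueStructure S public
  open ParentTree rank root par par-< public

  vertices : Fin M → List (Fin n)
  vertices = quad ν fa fb fc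

  face : Fin M → List (Fin n)
  face i = fa i ∷ fb i ∷ fc i ∷ []

  ν∈Q : ∀ i → ν i ∈ Q i
  ν∈Q i = quad⊆Q i _ (here refl)
  fa∈Q : ∀ i → fa i ∈ Q i
  fa∈Q i = quad⊆Q i _ (there (here refl))
  fb∈Q : ∀ i → fb i ∈ Q i
  fb∈Q i = quad⊆Q i _ (there (there (here refl)))
  fc∈Q : ∀ i → fc i ∈ Q i
  fc∈Q i = quad⊆Q i _ (there (there (there (here refl))))

  face-unique : ∀ i → Unique (face i)
  face-unique i with distinct i
  ... | _ ∷ u = u

  fa≢fb : ∀ i → fa i ≢ fb i
  fa≢fb i with face-unique i
  ... | (p ∷ _) ∷ _ = p
  fa≢fc : ∀ i → fa i ≢ fc i
  fa≢fc i with face-unique i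
  ... | (_ ∷ p ∷ _) ∷ _ = p
  fb≢fc : ∀ i → fb i ≢ fc i
  fb≢fc i with face-unique i
  ... | _ ∷ (p ∷ _) ∷ _ = p

  in-face : ∀ i x → x ∈ Q i → x ≢ ν i → x ∈ˡ face i
  in-face i x x∈ x≢ν with Q⊆quad i x x∈
  ... | here x≡ν = ⊥-elim (x≢ν x≡ν)
  ... | there x∈face = x∈face

  ν∉Q-par : ∀ i → i ≢ root → ν i ∉ Q (par i)
  ν∉Q-par i i≢r m = not-desc-par i≢r (new-in-subtree i (par i) m)

  ∩⁺ : ∀ {x} i j → x ∈ Q i → x ∈ Q j → x ∈ (Q i ∩ Q j)
  ∩⁺ i j a b = x∈p∩q⁺ (a , b)
  ∩ˡ : ∀ {x} i j → x ∈ (Q i ∩ Q j) → x ∈ Q i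
  ∩ˡ i j m = proj₁ (x∈p∩q⁻ (Q i) (Q j) m)
  ∩ʳ : ∀ {x} i j → x ∈ (Q i ∩ Q j) → x ∈ Q j
  ∩ʳ i j m = proj₂ (x∈p∩q⁻ (Q i) (Q j) m)

  -- The sets Q i all have four elements, so inclusion between them is equality ...
  ⊆-reverse : ∀ i j → Q i ⊆ Q j → Q j ⊆ Q i
  ⊆-reverse i j sub {x} x∈j with x ∈? Q i
  ... | yes x∈i = x∈i
  ... | no x∉i = ⊥-elim (<-irrefl refl (unique-⊆-length (x ∷ vertices i) (vertices j)
          (All.tabulate (λ y∈ x≡y → x∉i (quad⊆Q i _ (subst (_∈ˡ vertices i) (sym x≡y) y∈))) ∷ distinct i)
          λ { y (here refl) → Q⊆quad j y x∈j ; y (there y∈) → Q⊆quad j y (sub (quad⊆Q i y y∈)) }))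

  -- ... and by the tree structure it forces i = j.
  ⊆⇒≡ : ∀ i j → Q i ⊆ Q j → i ≡ j
  ⊆⇒≡ i j sub with i ≟ j
  ... | yes i≡j = i≡j
  ... | no i≢j with share3 i j (fa i) (fb i) (fc i) (fa≢fb i) (fa≢fc i) (fb≢fc i) (fa∈Q i) (fb∈Q i) (fc∈Q i)
                      (sub (fa∈Q i)) (sub (fb∈Q i)) (sub (fc∈Q i)) i≢j
  ... | inj₂ (i≢r , refl) = ⊥-elim (ν∉Q-par i i≢r (sub (ν∈Q i)))
  ... | inj₁ (j≢r , refl) = ⊥-elim (ν∉Q-par j j≢r (⊆-reverse (par j) j sub (ν∈Q j)))

  Q-injective : ∀ i j → Q i ≡ Q j → i ≡ j
  Q-injective i j e = ⊆⇒≡ i j (λ m → subst (_ ∈_) e m)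

  Q-maximal : ∀ i → IsMaximalClique G (Q i)
  Q-maximal i = Q-clique i , maximal
    where
    maximal : ∀ C → IsClique G C → Q i ⊆ C → C ⊆ Q i
    maximal C C-clique Qi⊆C with cover C C-clique
    ... | j , C⊆Qj with ⊆⇒≡ i j (λ m → C⊆Qj (Qi⊆C m))
    ... | refl = C⊆Qj

  maximal⇒Q : ∀ C → IsMaximalClique G C → ∃[ i ] Q i ≡ C
  maximal⇒Q C (C-clique , maximal) = let (i , C⊆Qi) = cover C C-clique in i , ⊆-antisym (maximal (Q i) (Q-clique i) C⊆Qi) C⊆Qi

  maximal-clique-count : HasCard (IsMaximalClique G) M
  maximal-clique-count = subst (HasCard (IsMaximalClique G)) (List.length-tabulate {n = M} (λ i → i))
    (HasCard-image Q (allFin M) (Unique.allFin⁺ M) (λ i j _ _ → Q-injective i j) (λ i _ → Q-maximal i)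
      (λ C C-max → let (i , Qi≡C) = maximal⇒Q C C-max in i , ∈-allFin i , Qi≡C))

  share3⇒adj : ∀ i j x y z → x ≢ y → x ≢ z → y ≢ z → x ∈ Q i → y ∈ Q i → z ∈ Q i →
               x ∈ Q j → y ∈ Q j → z ∈ Q j → i ≢ j → Adj T* i j
  share3⇒adj i j x y z x≢y x≢z y≢z xi yi zi xj yj zj i≢j = T*-adj⁺ (swap (share3 i j x y z x≢y x≢z y≢z xi yi zi xj yj zj i≢j))

  no-shared-triangle : ∀ p q r x y z → x ≢ y → x ≢ z → y ≢ z → p ≢ q → p ≢ r → q ≢ r →
                       x ∈ Q p → y ∈ Q p → z ∈ Q p → x ∈ Q q → y ∈ Q q → z ∈ Q q →
                       x ∈ Q r → y ∈ Q r → z ∈ Q r → ⊥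
  no-shared-triangle p q r x y z x≢y x≢z y≢z p≢q p≢r q≢r xp yp zp xq yq zq xr yr zr =
    T*-acyclic (p , r , (p ∷ q ∷ r ∷ []) ,
      step (share3⇒adj p q x y z x≢y x≢z y≢z xp yp zp xq yq zq p≢q)
           (step (share3⇒adj q r x y z x≢y x≢z y≢z xq yq zq xr yr zr q≢r) stop) ,
      (p≢q ∷ p≢r ∷ []) ∷ (q≢r ∷ []) ∷ [] ∷ [] , s≤s (s≤s (s≤s z≤n)) ,
      share3⇒adj r p x y z x≢y x≢z y≢z xr yr zr xp yp zp (λ e → p≢r (sym e)))

  ∩≥3⇒adj : ∀ i j → 3 ≤ ∣ Q i ∩ Q j ∣ → i ≢ j → Adj T* i j
  ∩≥3⇒adj i j 3≤ i≢j with three-elements (Q i ∩ Q j) 3≤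
  ... | x , y , z , x≢y , x≢z , y≢z , x∈ , y∈ , z∈ =
    share3⇒adj i j x y z x≢y x≢z y≢z (∩ˡ i j x∈) (∩ˡ i j y∈) (∩ˡ i j z∈) (∩ʳ i j x∈) (∩ʳ i j y∈) (∩ʳ i j z∈) i≢j

  -- A clique meets its parent exactly in its face.
  ∩-par≡3 : ∀ i → i ≢ root → ∣ Q i ∩ Q (par i) ∣ ≡ 3
  ∩-par≡3 i i≢r = ≤-antisym
    (∣∣-≤-length (Q i ∩ Q (par i)) (face i)
       (λ x m → in-face i x (∩ˡ i (par i) m) (λ { refl → ν∉Q-par i i≢r (∩ʳ i (par i) m) })))
    (length-≤-∣∣ (Q i ∩ Q (par i)) (face i) (face-unique i)
       (λ { x (here refl) → ∩⁺ i (par i) (fa∈Q i) (proj₁ (face-in-par i i≢r))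
          ; x (there (here refl)) → ∩⁺ i (par i) (fb∈Q i) (proj₁ (proj₂ (face-in-par i i≢r)))
          ; x (there (there (here refl))) → ∩⁺ i (par i) (fc∈Q i) (proj₂ (proj₂ (face-in-par i i≢r))) }))

  adj⇒∩≡3 : ∀ i j → Adj T* i j → ∣ Q i ∩ Q j ∣ ≡ 3
  adj⇒∩≡3 i j ij with T*-adj⁻ {i} {j} ij
  ... | inj₁ (i≢r , refl) = ∩-par≡3 i i≢r
  ... | inj₂ (j≢r , refl) = trans (cong ∣_∣ (∩-comm (Q i) (Q j))) (∩-par≡3 j j≢r)

  ∩≤3 : ∀ i j → i ≢ j → ∣ Q i ∩ Q j ∣ ≤ 3
  ∩≤3 i j i≢j with 3 ≤? ∣ Q i ∩ Q j ∣
  ... | yes 3≤ = ≤-reflexive (adj⇒∩≡3 i j (∩≥3⇒adj i j 3≤ i≢j))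
  ... | no 3≰ = ≤-trans (≤-pred (≰⇒> 3≰)) (s≤s (s≤s z≤n))

  T*-spanning : IsCliqueIntersectionSpanningTree Q T*
  T*-spanning = T*-sym , T*-irr , T*-tree , nonempty
    where
    nonempty : ∀ i j → Adj T* i j → Nonempty (Q i ∩ Q j)
    nonempty i j ij with T*-adj⁻ {i} {j} ij
    ... | inj₁ (i≢r , refl) = fa i , ∩⁺ i (par i) (fa∈Q i) (proj₁ (face-in-par i i≢r))
    ... | inj₂ (j≢r , refl) = fa j , ∩⁺ (par j) j (proj₁ (face-in-par j j≢r)) (fa∈Q j)

  vertex-cover : ∀ x → ∃[ z ] x ∈ Q z
  vertex-cover x with cover ⁅ x ⁆ (λ u v u∈ v∈ u≢v → ⊥-elim (u≢v (trans (x∈⁅y⁆⇒x≡y x u∈) (sym (x∈⁅y⁆⇒x≡y x v∈)))))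
  ... | z , sub = z , sub (x∈⁅x⁆ x)

  edge-cover : ∀ x y → Adj G x y → ∃[ z ] (x ∈ Q z × y ∈ Q z)
  edge-cover x y xy with cover (⁅ x ⁆ ∪ ⁅ y ⁆) pair-clique
    where
    one-of : ∀ v → v ∈ ⁅ x ⁆ ∪ ⁅ y ⁆ → v ≡ x ⊎ v ≡ y
    one-of v v∈ = Data.Sum.map (x∈⁅y⁆⇒x≡y x) (x∈⁅y⁆⇒x≡y y) (x∈p∪q⁻ ⁅ x ⁆ ⁅ y ⁆ v∈)
    pair-clique : IsClique G (⁅ x ⁆ ∪ ⁅ y ⁆)
    pair-clique u v u∈ v∈ u≢v with one-of u u∈ | one-of v v∈
    ... | inj₁ refl | inj₁ refl = ⊥-elim (u≢v refl)
    ... | inj₁ refl | inj₂ refl = xy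
    ... | inj₂ refl | inj₁ refl = trans (G-sym u v) xy
    ... | inj₂ refl | inj₂ refl = ⊥-elim (u≢v refl)
  ... | z , sub = z , sub (x∈p∪q⁺ (inj₁ (x∈⁅x⁆ x))) , sub (x∈p∪q⁺ (inj₂ (x∈⁅x⁆ y)))

  missing-vertex : ∀ q t → Adj T* q t → Σ (Fin n) λ x → x ∈ Q q × x ∉ Q t × (∀ y → y ∈ Q q → y ∉ Q t → y ≡ x)
  missing-vertex q t qt with violation-or-all (λ x → x ∈? Q t) (vertices q)
  ... | inj₂ all-in = ⊥-elim (adj⇒≢ T* T*-irr qt (⊆⇒≡ q t (λ {x} m → all-in x (Q⊆quad q x m))))
  ... | inj₁ (x , x∈ , x∉t) = x , quad⊆Q q x x∈ , x∉t , unique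
    where
    unique : ∀ y → y ∈ Q q → y ∉ Q t → y ≡ x
    unique y y∈q y∉t with y ≟ x
    ... | yes y≡x = y≡x
    ... | no y≢x with three-elements (Q q ∩ Q t) (≤-reflexive (sym (adj⇒∩≡3 q t qt)))
    ... | p₁ , p₂ , p₃ , p₁≢p₂ , p₁≢p₃ , p₂≢p₃ , m₁ , m₂ , m₃ =
      ⊥-elim (<-irrefl refl (unique-⊆-length (y ∷ x ∷ p₁ ∷ p₂ ∷ p₃ ∷ []) (vertices q) five-distinct five-in-q))
      where
      outside-t : ∀ {z w} → z ∉ Q t → w ∈ (Q q ∩ Q t) → z ≢ w
      outside-t z∉ w∈ refl = z∉ (∩ʳ q t w∈)
      five-distinct : Unique (y ∷ x ∷ p₁ ∷ p₂ ∷ p₃ ∷ [])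
      five-distinct = (y≢x ∷ outside-t y∉t m₁ ∷ outside-t y∉t m₂ ∷ outside-t y∉t m₃ ∷ [])
                    ∷ (outside-t x∉t m₁ ∷ outside-t x∉t m₂ ∷ outside-t x∉t m₃ ∷ [])
                    ∷ (p₁≢p₂ ∷ p₁≢p₃ ∷ []) ∷ (p₂≢p₃ ∷ []) ∷ [] ∷ []
      five-in-q : ∀ z → z ∈ˡ (y ∷ x ∷ p₁ ∷ p₂ ∷ p₃ ∷ []) → z ∈ˡ vertices q
      five-in-q z (here refl) = Q⊆quad q z y∈q
      five-in-q z (there (here refl)) = x∈
      five-in-q z (there (there (here refl))) = Q⊆quad q z (∩ˡ q t m₁)
      five-in-q z (there (there (there (here refl)))) = Q⊆quad q z (∩ˡ q t m₂)
      five-in-q z (there (there (there (there (here refl))))) = Q⊆quad q z (∩ˡ q t m₃)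

  -- (2) Minimal separators

  Sep : Fin M → Subset n
  Sep i = Q i ∩ Q (par i)

  NewBelow : Fin M → Fin n → Set
  NewBelow i x = ∃[ j ] (Desc i j × x ≡ ν j)

  subtree-vertex : ∀ i → i ≢ root → ∀ {j} → Desc i j → ∀ x → x ∈ Q j → NewBelow i x ⊎ x ∈ Sep i
  subtree-vertex i i≢r dhere x x∈ with x ≟ ν i
  ... | yes x≡ν = inj₁ (i , dhere , x≡ν)
  ... | no x≢ν with in-face i x x∈ x≢ν
  ... | here refl = inj₂ (∩⁺ i (par i) x∈ (proj₁ (face-in-par i i≢r)))
  ... | there (here refl) = inj₂ (∩⁺ i (par i) x∈ (proj₁ (proj₂ (face-in-par i i≢r))))
  ... | there (there (here refl)) = inj₂ (∩⁺ i (par i) x∈ (proj₂ (proj₂ (face-in-par i i≢r))))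
  subtree-vertex i i≢r (dup {j} j≢r d) x x∈ with x ≟ ν j
  ... | yes x≡ν = inj₁ (j , dup j≢r d , x≡ν)
  ... | no x≢ν with in-face j x x∈ x≢ν
  ... | here refl = subtree-vertex i i≢r d x (proj₁ (face-in-par j j≢r))
  ... | there (here refl) = subtree-vertex i i≢r d x (proj₁ (proj₂ (face-in-par j j≢r)))
  ... | there (there (here refl)) = subtree-vertex i i≢r d x (proj₂ (proj₂ (face-in-par j j≢r)))

  newBelow-step : ∀ i → i ≢ root → ∀ x y → NewBelow i x → Adj G x y → NewBelow i y ⊎ y ∈ Sep i
  newBelow-step i i≢r x y (j , i≼j , refl) xy with edge-cover x y xy
  ... | z , x∈ , y∈ = subtree-vertex i i≢r (desc-trans i≼j (new-in-subtree j z x∈)) y y∈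

  newBelow-∉par : ∀ i → i ≢ root → ∀ v → v ∈ Q (par i) → ¬ NewBelow i v
  newBelow-∉par i i≢r v v∈ (j , i≼j , refl) = not-desc-par i≢r (desc-trans i≼j (new-in-subtree j (par i) v∈))

  leaving-walk-meets-Sep : ∀ i → i ≢ root → ∀ {u v xs} → NewBelow i u → ¬ NewBelow i v → Walk G u v xs → Any (_∈ Sep i) xs
  leaving-walk-meets-Sep i i≢r new-u old-v stop = ⊥-elim (old-v new-u)
  leaving-walk-meets-Sep i i≢r {u} new-u old-v (step {w = y} uy wk) with u ∈? Sep i
  ... | yes u∈ = here u∈
  ... | no _ with newBelow-step i i≢r u y new-u uy
  ... | inj₁ new-y = there (leaving-walk-meets-Sep i i≢r new-y old-v wk)
  ... | inj₂ y∈ = there (Data.List.Relation.Unary.Any.map (λ { refl → y∈ }) (walk-start wk))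

  -- Sep i is a minimal separator of ν i and the vertex of the parent missing from Q i.
  Sep-minimal : ∀ i → i ≢ root → IsMinimalVertexSeparator G (Sep i)
  Sep-minimal i i≢r with missing-vertex (par i) i (T*-adj⁺ (inj₂ (i≢r , refl)))
  ... | v , v∈par , v∉i , _ = ν i , v , (ν≢v , ν≁v , ν∉Sep , v∉Sep , separates) , minimal
    where
    ν∉Sep : ν i ∉ Sep i
    ν∉Sep m = ν∉Q-par i i≢r (∩ʳ i (par i) m)
    ν≢v : ν i ≢ v
    ν≢v e = v∉i (subst (_∈ Q i) e (ν∈Q i))
    v∉Sep : v ∉ Sep i
    v∉Sep m = v∉i (∩ˡ i (par i) m)
    separates : ∀ xs → Walk G (ν i) v xs → Any (_∈ Sep i) xs
    separates xs wk = leaving-walk-meets-Sep i i≢r (i , dhere , refl) (newBelow-∉par i i≢r v v∈par) wk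
    ν≁v : ¬ Adj G (ν i) v
    ν≁v a = All¬⇒¬Any (ν∉Sep ∷ v∉Sep ∷ []) (separates _ (step a stop))
    -- through a vertex s ∈ Sep i missing from S′, the walk ν i — s — v avoids S′
    minimal : ∀ S′ → S′ ⊂ Sep i → ¬ IsSeparator G (ν i) v S′
    minimal S′ (_ , s , s∈ , s∉) (_ , _ , ν∉ , v∉ , sep) = All¬⇒¬Any (ν∉ ∷ s∉ ∷ v∉ ∷ []) (sep _ (step νs (step sv stop)))
      where
      νs : Adj G (ν i) s
      νs = Q-clique i (ν i) s (ν∈Q i) (∩ˡ i (par i) s∈) (λ e → ν∉Q-par i i≢r (subst (_∈ Q (par i)) (sym e) (∩ʳ i (par i) s∈)))
      sv : Adj G s v
      sv = Q-clique (par i) s v (∩ʳ i (par i) s∈) v∈par (λ e → v∉i (subst (_∈ Q i) e (∩ˡ i (par i) s∈)))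

  join-through-clique : ∀ (T : Subset n) c {u v y₁ y₂ xs ys} → y₁ ∈ Q c → y₂ ∈ Q c →
                        Walk G u y₁ xs → All (_∉ T) xs → Walk G v y₂ ys → All (_∉ T) ys →
                        Σ (List (Fin n)) λ zs → Walk G u v zs × All (_∉ T) zs
  join-through-clique T c {y₁ = y₁} {y₂} y₁∈ y₂∈ wk₁ avoid₁ wk₂ avoid₂ =
    let (_ , middle , avoid-m) = y₁→y₂
        (_ , wk , avoid) = walk-append-All middle (walk-reverse G-sym wk₂) avoid-m (reverse-All avoid₂)
    in walk-append-All wk₁ wk avoid₁ avoid
    where
    last-avoids : ∀ {s t zs} → Walk G s t zs → All (_∉ T) zs → t ∉ T
    last-avoids wk avoid = All.lookup avoid (walk-end wk)
    y₁→y₂ : Σ (List (Fin n)) λ zs → Walk G y₁ y₂ zs × All (_∉ T) zs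
    y₁→y₂ with y₁ ≟ y₂
    ... | yes refl = _ , stop , last-avoids wk₁ avoid₁ ∷ []
    ... | no y₁≢y₂ = _ , step (Q-clique c y₁ y₂ y₁∈ y₂∈ y₁≢y₂) stop , last-avoids wk₁ avoid₁ ∷ last-avoids wk₂ avoid₂ ∷ []

  climb : ∀ c (T : Subset n) {j} → Desc c j → ∀ x → x ∈ Q j → x ∉ T →
          (Σ (Fin M) λ j′ → Desc c j′ × c ≢ j′ × Desc j′ j × Sep j′ ⊆ T) ⊎
          (Σ (Fin n) λ y → y ∈ Q c × Σ (List (Fin n)) λ ys → Walk G x y ys × All (_∉ T) ys)
  climb c T dhere x x∈ x∉T = inj₂ (x , x∈ , _ , stop , x∉T ∷ [])
  climb c T (dup {j} j≢r d) x x∈ x∉T with violation-or-all (_∈? T) (members (Sep j))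
  ... | inj₂ Sep⊆T = inj₁ (j , dup j≢r d , c≢j , dhere , λ {y} y∈ → Sep⊆T y (members⁺ (Sep j) y∈))
    where
    c≢j : c ≢ j
    c≢j refl = not-desc-par j≢r d
  ... | inj₁ (y , y∈ , y∉T) with climb c T d y (∩ʳ j (par j) (members⁻ _ y∈)) y∉T
  ... | inj₁ (j′ , c≼j′ , c≢j′ , j′≼pj , sub) = inj₁ (j′ , c≼j′ , c≢j′ , dup j≢r j′≼pj , sub)
  ... | inj₂ (z , z∈c , ys , wk , avoid) with x ≟ y
  ... | yes refl = inj₂ (z , z∈c , ys , wk , avoid)
  ... | no x≢y = inj₂ (z , z∈c , _ , step (Q-clique j x y x∈ (∩ˡ j (par j) (members⁻ _ y∈)) x≢y) wk , x∉T ∷ avoid)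

  deepest-common-ancestor : ∀ a b → Σ (Fin M) λ c → Desc c a × Desc c b × (∀ c′ → Desc c′ a → Desc c′ b → rank c′ ≤ rank c)
  deepest-common-ancestor a b = c , proj₁ c-common , proj₂ c-common ,
                                 λ c′ c′≼a c′≼b → c-max c′ (∈-filter⁺ common? (∈-allFin c′) (c′≼a , c′≼b))
    where
    common? : ∀ c → Dec (Desc c a × Desc c b)
    common? c = desc? c a ×-dec desc? c b
    deepest : Σ (Fin M) λ c → c ∈ˡ filter common? (allFin M) × (∀ c′ → c′ ∈ˡ filter common? (allFin M) → rank c′ ≤ rank c)
    deepest = argmax rank (filter common? (allFin M)) (∈-filter⁺ common? (∈-allFin root) (root-desc a , root-desc b))
    c : Fin M
    c = proj₁ deepest
    c-common : Desc c a × Desc c b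
    c-common = proj₂ (∈-filter⁻ common? {xs = allFin M} (proj₁ (proj₂ deepest)))
    c-max : ∀ c′ → c′ ∈ˡ filter common? (allFin M) → rank c′ ≤ rank c
    c-max = proj₂ (proj₂ deepest)

  below-deepest : ∀ {a b c j x y} → (∀ c′ → Desc c′ a → Desc c′ b → rank c′ ≤ rank c) →
                  Desc c j → c ≢ j → Desc j a → x ∈ Q a → x ∉ Sep j → y ∈ Q b → NewBelow j x × ¬ NewBelow j y
  below-deepest {a} {b} deepest c≼j c≢j j≼a x∈a x∉Sep y∈b = new-x , old-y
    where
    new-x : NewBelow _ _
    new-x = [ (λ new → new) , (λ x∈Sep → ⊥-elim (x∉Sep x∈Sep)) ] (subtree-vertex _ (desc-≢root c≼j c≢j) j≼a _ x∈a)
    old-y : ¬ NewBelow _ _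
    old-y (z , j≼z , refl) = <-irrefl refl (<-≤-trans (desc-< c≼j c≢j) (deepest _ j≼a (desc-trans j≼z (new-in-subtree z b y∈b))))

  Sep-separates : ∀ j → j ≢ root → ∀ {u v xs} → (NewBelow j u × ¬ NewBelow j v) ⊎ (NewBelow j v × ¬ NewBelow j u) →
                  Walk G u v xs → Any (_∈ Sep j) xs
  Sep-separates j j≢r (inj₁ (new-u , old-v)) wk = leaving-walk-meets-Sep j j≢r new-u old-v wk
  Sep-separates j j≢r (inj₂ (new-v , old-u)) wk = Any-reverse⁻ (leaving-walk-meets-Sep j j≢r new-v old-u (walk-reverse G-sym wk))

  Sep-is-T : ∀ T u v → IsMinimalSeparatorFor G u v T → ∀ j → j ≢ root → Sep j ⊆ T →
             (NewBelow j u × ¬ NewBelow j v) ⊎ (NewBelow j v × ¬ NewBelow j u) → Sep j ≡ T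
  Sep-is-T T u v ((u≢v , u≁v , u∉T , v∉T , _) , minimal) j j≢r Sep⊆T sides with violation-or-all (_∈? Sep j) (members T)
  ... | inj₁ (x , x∈T , x∉Sep) = ⊥-elim (minimal (Sep j) (Sep⊆T , x , members⁻ T x∈T , x∉Sep)
          (u≢v , u≁v , (λ m → u∉T (Sep⊆T m)) , (λ m → v∉T (Sep⊆T m)) , λ xs wk → Sep-separates j j≢r sides wk))
  ... | inj₂ T⊆Sep = ⊆-antisym Sep⊆T (λ {y} m → T⊆Sep y (members⁺ T m))

  separator-is-Sep : ∀ T → IsMinimalVertexSeparator G T → Σ (Fin M) λ i → i ≢ root × Sep i ≡ T
  separator-is-Sep T (u , v , T-min@((_ , _ , u∉T , v∉T , separates) , _))
    with vertex-cover u | vertex-cover v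
  ... | a , u∈a | b , v∈b with deepest-common-ancestor a b
  ... | c , c≼a , c≼b , deepest with climb c T c≼a u u∈a u∉T | climb c T c≼b v v∈b v∉T
  ... | inj₁ (j , c≼j , c≢j , j≼a , Sep⊆T) | _ = j , desc-≢root c≼j c≢j ,
    Sep-is-T T u v T-min j (desc-≢root c≼j c≢j) Sep⊆T (inj₁ (below-deepest deepest c≼j c≢j j≼a u∈a (λ m → u∉T (Sep⊆T m)) v∈b))
  ... | inj₂ _ | inj₁ (j , c≼j , c≢j , j≼b , Sep⊆T) = j , desc-≢root c≼j c≢j ,
    Sep-is-T T u v T-min j (desc-≢root c≼j c≢j) Sep⊆T
      (inj₂ (below-deepest (λ c′ db da → deepest c′ da db) c≼j c≢j j≼b v∈b (λ m → v∉T (Sep⊆T m)) u∈a))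
  ... | inj₂ (y₁ , y₁∈c , _ , wk₁ , avoid₁) | inj₂ (y₂ , y₂∈c , _ , wk₂ , avoid₂) =
    let (_ , wk , avoid) = join-through-clique T c y₁∈c y₂∈c wk₁ avoid₁ wk₂ avoid₂
    in ⊥-elim (All¬⇒¬Any avoid (separates _ wk))

  -- Distinct non-root cliques have distinct separators (else three cliques share a triangle).
  Sep-injective : ∀ i j → i ≢ root → j ≢ root → Sep i ≡ Sep j → i ≡ j
  Sep-injective i j i≢r j≢r e with i ≟ j
  ... | yes i≡j = i≡j
  ... | no i≢j = ⊥-elim (no-shared-triangle i (par i) k (fa i) (fb i) (fc i) (fa≢fb i) (fa≢fc i) (fb≢fc i)
                           (λ e′ → par-≢ i i≢r (sym e′)) i≢k pi≢k (fa∈Q i) (fb∈Q i) (fc∈Q i) fa∈p fb∈p fc∈p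
                           (into (fa∈Q i) fa∈p) (into (fb∈Q i) fb∈p) (into (fc∈Q i) fc∈p))
    where
    fa∈p : fa i ∈ Q (par i)
    fa∈p = proj₁ (face-in-par i i≢r)
    fb∈p : fb i ∈ Q (par i)
    fb∈p = proj₁ (proj₂ (face-in-par i i≢r))
    fc∈p : fc i ∈ Q (par i)
    fc∈p = proj₂ (proj₂ (face-in-par i i≢r))
    -- the third clique containing the face of i: j itself, or par j if j = par i
    third : Dec (par i ≡ j) → Σ (Fin M) λ k → i ≢ k × par i ≢ k × (∀ {x} → x ∈ Sep j → x ∈ Q k)
    third (no pi≢j) = j , i≢j , pi≢j , ∩ˡ j (par j)
    third (yes refl) = par (par i) , i≢ppi , (λ e′ → par-≢ (par i) j≢r (sym e′)) , ∩ʳ (par i) (par (par i))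
      where
      i≢ppi : i ≢ par (par i)
      i≢ppi e′ = <-irrefl (cong rank (sym e′)) (<-trans (par-< (par i) j≢r) (par-< i i≢r))
    k : Fin M
    k = proj₁ (third (par i ≟ j))
    i≢k : i ≢ k
    i≢k = proj₁ (proj₂ (third (par i ≟ j)))
    pi≢k : par i ≢ k
    pi≢k = proj₁ (proj₂ (proj₂ (third (par i ≟ j))))
    into : ∀ {x} → x ∈ Q i → x ∈ Q (par i) → x ∈ Q k
    into x∈i x∈p = proj₂ (proj₂ (proj₂ (third (par i ≟ j)))) (subst (_ ∈_) e (∩⁺ i (par i) x∈i x∈p))

  separator-count : HasCard (IsMinimalVertexSeparator G) (M ∸ 1)
  separator-count = subst (HasCard (IsMinimalVertexSeparator G)) non-roots-length
    (HasCard-image Sep non-roots non-roots-unique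
      (λ i j i∈ j∈ → Sep-injective i j (∈-non-roots⁻ i∈) (∈-non-roots⁻ j∈))
      (λ i i∈ → Sep-minimal i (∈-non-roots⁻ i∈))
      (λ T T-min → let (i , i≢r , e) = separator-is-Sep T T-min in i , ∈-non-roots⁺ i i≢r , e))

  -- (3)–(5) Neighbourhoods in T*

  shared-with-neighbour : ∀ q z x → x ∈ Q q → x ∈ Q z → q ≢ z → Σ (Fin M) λ t → Adj T* q t × x ∈ Q t
  shared-with-neighbour q z x x∈q x∈z q≢z with desc? q z
  ... | yes q≼z with child-towards q≼z q≢z
  ... | c , c≢r , refl , c≼z with subtree-vertex c c≢r c≼z x x∈z
  ... | inj₁ new = ⊥-elim (newBelow-∉par c c≢r x x∈q new)
  ... | inj₂ x∈Sep = c , T*-adj⁺ (inj₂ (c≢r , refl)) , ∩ˡ c (par c) x∈Sep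
  shared-with-neighbour q z x x∈q x∈z q≢z | no q⋠z with x ≟ ν q
  ... | yes refl = ⊥-elim (q⋠z (new-in-subtree q z x∈z))
  ... | no x≢ν with in-face q x x∈q x≢ν
  ... | here refl = par q , T*-adj⁺ (inj₁ (q≢r , refl)) , proj₁ (face-in-par q q≢r)
    where q≢r = ¬desc⇒≢root q⋠z
  ... | there (here refl) = par q , T*-adj⁺ (inj₁ (q≢r , refl)) , proj₁ (proj₂ (face-in-par q q≢r))
    where q≢r = ¬desc⇒≢root q⋠z
  ... | there (there (here refl)) = par q , T*-adj⁺ (inj₁ (q≢r , refl)) , proj₂ (proj₂ (face-in-par q q≢r))
    where q≢r = ¬desc⇒≢root q⋠z

  shared-in-separator : ∀ q t x → Adj T* q t → x ∈ Q q → x ∈ Q t → ∃[ S′ ] (IsMinimalVertexSeparator G S′ × x ∈ S′)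
  shared-in-separator q t x qt x∈q x∈t with T*-adj⁻ {q} {t} qt
  ... | inj₁ (q≢r , refl) = Sep q , Sep-minimal q q≢r , ∩⁺ q (par q) x∈q x∈t
  ... | inj₂ (t≢r , refl) = Sep t , Sep-minimal t t≢r , ∩⁺ t (par t) x∈t x∈q

  -- the vertex of Q q missing from Q t (meaningful when q and t are T*-adjacent)
  missing : Fin M → Fin M → Fin n
  missing q t with violation-or-all (_∈? Q t) (vertices q)
  ... | inj₁ (x , _) = x
  ... | inj₂ _ = ν q

  missing-∈ : ∀ q t → missing q t ∈ Q q
  missing-∈ q t with violation-or-all (_∈? Q t) (vertices q)
  ... | inj₁ (x , x∈ , _) = quad⊆Q q x x∈
  ... | inj₂ _ = ν∈Q q

  missing-∉ : ∀ q t → Adj T* q t → missing q t ∉ Q t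
  missing-∉ q t qt with violation-or-all (_∈? Q t) (vertices q)
  ... | inj₁ (x , _ , x∉t) = x∉t
  ... | inj₂ all-in = ⊥-elim (adj⇒≢ T* T*-irr qt (⊆⇒≡ q t (λ {x} m → all-in x (Q⊆quad q x m))))

  missing-unique : ∀ q t → Adj T* q t → ∀ y → y ∈ Q q → y ∉ Q t → y ≡ missing q t
  missing-unique q t qt y y∈q y∉t with missing-vertex q t qt
  ... | x , _ , _ , only-x = trans (only-x y y∈q y∉t) (sym (only-x _ (missing-∈ q t) (missing-∉ q t qt)))

  -- Distinct neighbours of q miss distinct vertices of Q q: otherwise they would both
  -- contain the three vertices of Q q ∩ Q t₁, and q, t₁, t₂ would share a triangle.
  missing-injective : ∀ q t₁ t₂ → Adj T* q t₁ → Adj T* q t₂ → missing q t₁ ≡ missing q t₂ → t₁ ≡ t₂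
  missing-injective q t₁ t₂ qt₁ qt₂ same with t₁ ≟ t₂
  ... | yes t₁≡t₂ = t₁≡t₂
  ... | no t₁≢t₂ with three-elements (Q q ∩ Q t₁) (≤-reflexive (sym (adj⇒∩≡3 q t₁ qt₁)))
  ... | p₁ , p₂ , p₃ , p₁≢p₂ , p₁≢p₃ , p₂≢p₃ , m₁ , m₂ , m₃ =
    ⊥-elim (no-shared-triangle q t₁ t₂ p₁ p₂ p₃ p₁≢p₂ p₁≢p₃ p₂≢p₃ (adj⇒≢ T* T*-irr qt₁) (adj⇒≢ T* T*-irr qt₂) t₁≢t₂
              (∩ˡ q t₁ m₁) (∩ˡ q t₁ m₂) (∩ˡ q t₁ m₃) (∩ʳ q t₁ m₁) (∩ʳ q t₁ m₂) (∩ʳ q t₁ m₃) (in-t₂ m₁) (in-t₂ m₂) (in-t₂ m₃))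
    where
    in-t₂ : ∀ {p} → p ∈ (Q q ∩ Q t₁) → p ∈ Q t₂
    in-t₂ {p} m with p ∈? Q t₂
    ... | yes p∈ = p∈
    ... | no p∉ = ⊥-elim (missing-∉ q t₁ qt₁ (subst (_∈ Q t₁) (trans (missing-unique q t₂ qt₂ p (∩ˡ q t₁ m) p∉) (sym same))
                                                      (∩ʳ q t₁ m)))

  neighbours : Fin M → List (Fin M)
  neighbours q = select (T* q) (allFin M)

  neighbours-unique : ∀ q → Unique (neighbours q)
  neighbours-unique q = select-unique (T* q) (Unique.allFin⁺ M)

  ∈-neighbours⁺ : ∀ q t → Adj T* q t → t ∈ˡ neighbours q
  ∈-neighbours⁺ q t qt = ∈-select⁺ (T* q) (∈-allFin t) qt

  ∈-neighbours⁻ : ∀ q t → t ∈ˡ neighbours q → Adj T* q t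
  ∈-neighbours⁻ q t t∈ = proj₂ (∈-select⁻ (T* q) (allFin M) t∈)

  degree-neighbours : ∀ q → degree T* q ≡ length (neighbours q)
  degree-neighbours q = sum-indicator (T* q) (allFin M)

  T*-degree≤4 : ∀ q → degree T* q ≤ 4
  T*-degree≤4 q = subst (_≤ 4) (sym (degree-neighbours q))
    (injective-length (missing q) (neighbours q) (vertices q) (neighbours-unique q)
      (λ t₁ t₂ t₁∈ t₂∈ → missing-injective q t₁ t₂ (∈-neighbours⁻ q t₁ t₁∈) (∈-neighbours⁻ q t₂ t₂∈))
      (λ t _ → Q⊆quad q _ (missing-∈ q t)))

  -- (4) Every vertex of a clique with two T*-neighbours lies in a minimal separator:
  -- at most one of the two neighbours can miss it.
  internal-in-separators : ∀ q → 2 ≤ degree T* q → ∀ x → x ∈ Q q → ∃[ S′ ] (IsMinimalVertexSeparator G S′ × x ∈ S′)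
  internal-in-separators q 2≤ x x∈q
    with two-entries (neighbours q) (subst (2 ≤_) (degree-neighbours q) 2≤) (neighbours-unique q)
  ... | t₁ , t₂ , t₁∈ , t₂∈ , t₁≢t₂ with x ∈? Q t₁ | x ∈? Q t₂
  ... | yes x∈t₁ | _ = shared-in-separator q t₁ x (∈-neighbours⁻ q t₁ t₁∈) x∈q x∈t₁
  ... | no _ | yes x∈t₂ = shared-in-separator q t₂ x (∈-neighbours⁻ q t₂ t₂∈) x∈q x∈t₂
  ... | no x∉t₁ | no x∉t₂ = ⊥-elim (t₁≢t₂ (missing-injective q t₁ t₂ qt₁ qt₂
          (trans (sym (missing-unique q t₁ qt₁ x x∈q x∉t₁)) (missing-unique q t₂ qt₂ x x∈q x∉t₂))))
    where
    qt₁ : Adj T* q t₁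
    qt₁ = ∈-neighbours⁻ q t₁ t₁∈
    qt₂ : Adj T* q t₂
    qt₂ = ∈-neighbours⁻ q t₂ t₂∈

  -- the first T*-neighbour of q (q itself when there is none)
  first-neighbour : Fin M → Fin M
  first-neighbour q with neighbours q
  ... | [] = q
  ... | t ∷ _ = t

  leaf-neighbours : ∀ q → degree T* q ≡ 1 → neighbours q ≡ first-neighbour q ∷ []
  leaf-neighbours q deg1 with neighbours q | degree-neighbours q
  ... | t ∷ [] | _ = refl
  ... | [] | e with trans (sym deg1) e
  ... | ()
  leaf-neighbours q deg1 | _ ∷ _ ∷ _ | e with trans (sym deg1) e
  ... | ()

  -- the vertex of Q q missing from its first neighbour; for a leaf, the vertex owned by q alone
  private-vertex : Fin M → Fin n
  private-vertex q = missing q (first-neighbour q)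

  module Leaf (q : Fin M) (deg1 : degree T* q ≡ 1) where
    t : Fin M
    t = first-neighbour q

    q~t : Adj T* q t
    q~t = ∈-neighbours⁻ q t (subst (t ∈ˡ_) (sym (leaf-neighbours q deg1)) (here refl))

    only-neighbour : ∀ t′ → Adj T* q t′ → t′ ≡ t
    only-neighbour t′ qt′ with subst (t′ ∈ˡ_) (leaf-neighbours q deg1) (∈-neighbours⁺ q t′ qt′)
    ... | here t′≡t = t′≡t

    private-∈ : private-vertex q ∈ Q q
    private-∈ = missing-∈ q t

    -- Were the private vertex in another clique, it would be in a neighbour, i.e. in Q t.
    private-only : ∀ z → private-vertex q ∈ Q z → z ≡ q
    private-only z x∈z with z ≟ q
    ... | yes z≡q = z≡q
    ... | no z≢q with shared-with-neighbour q z (private-vertex q) private-∈ x∈z (λ e → z≢q (sym e))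
    ... | t′ , qt′ , x∈t′ = ⊥-elim (missing-∉ q t q~t (subst (λ s → private-vertex q ∈ Q s) (only-neighbour t′ qt′) x∈t′))

    -- Each edge at the private vertex lies in a clique, necessarily Q q.
    private-simplicial : IsSimplicial G (private-vertex q)
    private-simplicial a b xa xb a≢b with edge-cover _ a xa | edge-cover _ b xb
    ... | z₁ , x∈z₁ , a∈z₁ | z₂ , x∈z₂ , b∈z₂ with private-only z₁ x∈z₁ | private-only z₂ x∈z₂
    ... | refl | refl = Q-clique q a b a∈z₁ b∈z₂ a≢b

  -- A simplicial vertex x lies in exactly one clique: its closed neighbourhood is a clique.
  simplicial-home : ∀ x → IsSimplicial G x → Σ (Fin M) λ q → x ∈ Q q × (∀ z → x ∈ Q z → z ≡ q)
  simplicial-home x x-simplicial = q , N⊆Q (x∈p∪q⁺ (inj₁ (x∈⁅x⁆ x))) , only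
    where
    N : Subset n
    N = ⁅ x ⁆ ∪ tabulate (G x)
    ∈N⁻ : ∀ {v} → v ∈ N → v ≡ x ⊎ Adj G x v
    ∈N⁻ {v} m = Data.Sum.map (x∈⁅y⁆⇒x≡y x) (∈-tabulate⁻ (G x) v) (x∈p∪q⁻ ⁅ x ⁆ _ m)
    ∈N⁺ : ∀ {v} → v ≡ x ⊎ Adj G x v → v ∈ N
    ∈N⁺ (inj₁ refl) = x∈p∪q⁺ (inj₁ (x∈⁅x⁆ x))
    ∈N⁺ {v} (inj₂ xv) = x∈p∪q⁺ (inj₂ (∈-tabulate⁺ (G x) v xv))
    N-clique : IsClique G N
    N-clique u v u∈ v∈ u≢v with ∈N⁻ u∈ | ∈N⁻ v∈
    ... | inj₁ refl | inj₁ refl = ⊥-elim (u≢v refl)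
    ... | inj₁ refl | inj₂ xv = xv
    ... | inj₂ xu | inj₁ refl = trans (G-sym u v) xu
    ... | inj₂ xu | inj₂ xv = x-simplicial u v xu xv u≢v
    q : Fin M
    q = proj₁ (cover N N-clique)
    N⊆Q : N ⊆ Q q
    N⊆Q = proj₂ (cover N N-clique)
    only : ∀ z → x ∈ Q z → z ≡ q
    only z x∈z = ⊆⇒≡ z q λ {y} y∈z → N⊆Q (∈N⁺ (neighbour y y∈z))
      where
      neighbour : ∀ y → y ∈ Q z → y ≡ x ⊎ Adj G x y
      neighbour y y∈z with y ≟ x
      ... | yes y≡x = inj₁ y≡x
      ... | no y≢x = inj₂ (Q-clique z x y x∈z y∈z (λ e → y≢x (sym e)))

  -- With at least two cliques, every clique has a T*-neighbour (its parent, or a child of the root).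
  has-neighbour : (∃[ j ] j ≢ root) → ∀ q → Σ (Fin M) λ t → Adj T* q t
  has-neighbour (j , j≢r) q = by-cases (q ≟ root)
    where
    by-cases : Dec (q ≡ root) → Σ (Fin M) λ t → Adj T* q t
    by-cases (no q≢r) = par q , T*-adj⁺ (inj₁ (q≢r , refl))
    by-cases (yes q≡r) = let (c , c≢r , pc≡r , _) = child-towards (root-desc j) (λ e → j≢r (sym e))
                         in c , T*-adj⁺ (inj₂ (c≢r , trans q≡r (sym pc≡r)))

  -- A clique owning a vertex x (in no other clique) is a leaf: all its neighbours miss x.
  owner-is-leaf : (∃[ j ] j ≢ root) → ∀ q x → x ∈ Q q → (∀ z → x ∈ Q z → z ≡ q) → degree T* q ≡ 1
  owner-is-leaf non-root q x x∈q only = trans (degree-neighbours q) (≤-antisym at-most-one at-least-one)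
    where
    t₀ : Fin M
    t₀ = proj₁ (has-neighbour non-root q)
    qt₀ : Adj T* q t₀
    qt₀ = proj₂ (has-neighbour non-root q)
    x∉nbr : ∀ t → Adj T* q t → x ∉ Q t
    x∉nbr t qt x∈t = adj⇒≢ T* T*-irr qt (sym (only t x∈t))
    at-most-one : length (neighbours q) ≤ 1
    at-most-one = unique-⊆-length (neighbours q) (t₀ ∷ []) (neighbours-unique q) λ t t∈ →
      let qt = ∈-neighbours⁻ q t t∈
      in here (missing-injective q t t₀ qt qt₀
                 (trans (sym (missing-unique q t qt x x∈q (x∉nbr t qt))) (missing-unique q t₀ qt₀ x x∈q (x∉nbr t₀ qt₀))))
    at-least-one : 1 ≤ length (neighbours q)
    at-least-one = unique-⊆-length (t₀ ∷ []) (neighbours q) ([] ∷ []) (λ { t (here refl) → ∈-neighbours⁺ q t₀ qt₀ })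

  leaves : List (Fin M)
  leaves = filter (λ q → degree T* q ≟ℕ 1) (allFin M)

  ∈-leaves⁻ : ∀ {q} → q ∈ˡ leaves → degree T* q ≡ 1
  ∈-leaves⁻ q∈ = proj₂ (∈-filter⁻ (λ q → degree T* q ≟ℕ 1) {xs = allFin M} q∈)

  leaves-unique : Unique leaves
  leaves-unique = Unique.filter⁺ (λ q → degree T* q ≟ℕ 1) {allFin M} (Unique.allFin⁺ M)

  leaf-count : HasCard (λ q → degree T* q ≡ 1) (length leaves)
  leaf-count = leaves , leaves-unique , (λ q q∈ → ∈-leaves⁻ q∈) ,
               (λ q deg1 → ∈-filter⁺ (λ q → degree T* q ≟ℕ 1) (∈-allFin q) deg1) , refl

  -- Private vertices of leaves are exactly the simplicial vertices.
  simplicial-count : (∃[ j ] j ≢ root) → HasCard (IsSimplicial G) (length leaves)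
  simplicial-count non-root = HasCard-image private-vertex leaves leaves-unique
    (λ q q′ q∈ q′∈ e → sym (Leaf.private-only q (∈-leaves⁻ q∈) q′ (subst (_∈ Q q′) (sym e) (Leaf.private-∈ q′ (∈-leaves⁻ q′∈)))))
    (λ q q∈ → Leaf.private-simplicial q (∈-leaves⁻ q∈))
    onto
    where
    onto : ∀ x → IsSimplicial G x → Σ (Fin M) λ q → q ∈ˡ leaves × private-vertex q ≡ x
    onto x x-simplicial with simplicial-home x x-simplicial
    ... | q , x∈q , only = q , ∈-filter⁺ (λ q → degree T* q ≟ℕ 1) (∈-allFin q) deg1 ,
                           sym (missing-unique q t q~t x x∈q (λ x∈t → adj⇒≢ T* T*-irr q~t (sym (only t x∈t))))
      where
      deg1 : degree T* q ≡ 1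
      deg1 = owner-is-leaf non-root q x x∈q only
      open Leaf q deg1 using (t; q~t)

  non-complete⇒non-root : NonComplete G → ∃[ j ] j ≢ root
  non-complete⇒non-root (u , v , u≢v , u≁v) with vertex-cover u | vertex-cover v
  ... | z₁ , u∈ | z₂ , v∈ with z₁ ≟ z₂
  ... | yes refl = ⊥-elim (u≁v (Q-clique z₁ u v u∈ v∈ u≢v))
  ... | no z₁≢z₂ with z₁ ≟ root
  ... | yes refl = z₂ , λ e → z₁≢z₂ (sym e)
  ... | no z₁≢r = z₁ , z₁≢r

-- Every clique-tree is the construction tree

-- For a clique-tree CT whose cliques carry a clique structure, the tree of CT is T*:
-- T* has weight 3(m − 1), a forest has at most m − 1 edges each of weight ≤ 3, so a
-- maximum-weight tree uses only edges of weight 3, i.e. edges of T*, and then all of them.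
module CliqueTreeIsT* {n : ℕ} {G : Graph n} (CT : CliqueTree G) (S : CliqueStructure G (CliqueTree.m CT) (CliqueTree.clique CT)) where
  open CliqueTree CT
  open Cliques S

  tree-sym : Symmetric tree
  tree-sym = proj₁ spanning
  tree-irr : Irreflexive tree
  tree-irr = proj₁ (proj₂ spanning)
  tree-connected : Connected tree
  tree-connected = proj₁ (proj₁ (proj₂ (proj₂ spanning)))
  tree-acyclic : ¬ HasCycle tree
  tree-acyclic = proj₂ (proj₁ (proj₂ (proj₂ spanning)))

  Pair : Set
  Pair = Fin m × Fin m

  pairs : List Pair
  pairs = cartesianProduct (allFin m) (allFin m)

  pairs-unique : Unique pairs
  pairs-unique = Unique.cartesianProduct⁺ (Unique.allFin⁺ m) (Unique.allFin⁺ m)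

  ∈-pairs : ∀ e → e ∈ˡ pairs
  ∈-pairs (i , j) = ∈-cartesianProduct⁺ (∈-allFin i) (∈-allFin j)

  is-edge : Graph m → Pair → Bool
  is-edge T′ (i , j) = (toℕ i <ᵇ toℕ j) ∧ T′ i j

  edges : Graph m → List Pair
  edges T′ = select (is-edge T′) pairs

  ∧-true : ∀ {a b} → a ∧ b ≡ true → a ≡ true × b ≡ true
  ∧-true {true} {true} _ = refl , refl

  edges-count : ∀ T′ → HasCard (EdgeOf T′) (length (edges T′))
  edges-count T′ = edges T′ , select-unique (is-edge T′) pairs-unique ,
    (λ { (i , j) e∈ → ∧-true (proj₂ (∈-select⁻ (is-edge T′) pairs e∈)) }) ,
    (λ { (i , j) (i<j , ij) → ∈-select⁺ (is-edge T′) (∈-pairs (i , j)) (subst (λ b → b ∧ T′ i j ≡ true) (sym i<j) ij) }) , refl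

  edge-weight : Pair → ℕ
  edge-weight (i , j) = ∣ clique i ∩ clique j ∣

  weight-as-sum : ∀ T′ → weight clique T′ ≡ sum (map edge-weight (edges T′))
  weight-as-sum T′ = trans (sum-double f (allFin m) (allFin m))
    (trans (cong sum (List.map-cong guarded pairs)) (sum-guarded (is-edge T′) edge-weight pairs))
    where
    f : Fin m → Fin m → ℕ
    f i j = if (toℕ i <ᵇ toℕ j) then (if T′ i j then ∣ clique i ∩ clique j ∣ else 0) else 0
    guarded : ∀ e → f (proj₁ e) (proj₂ e) ≡ (if is-edge T′ e then edge-weight e else 0)
    guarded (i , j) with toℕ i <ᵇ toℕ j
    ... | true = refl
    ... | false = refl

  -- Every edge of T* has weight 3, so T* has weight 3(m − 1).
  T*-weight : weight clique T* ≡ 3 * (m ∸ 1)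
  T*-weight = trans (weight-as-sum T*) (trans (sum-const edge-weight 3 (edges T*) weight-3)
                                              (cong (3 *_) (HasCard-unique (edges-count T*) T*-edge-count)))
    where
    weight-3 : ∀ e → e ∈ˡ edges T* → edge-weight e ≡ 3
    weight-3 (i , j) e∈ = adj⇒∩≡3 i j (proj₂ (∧-true (proj₂ (∈-select⁻ (is-edge T*) pairs e∈))))

  edge-of-tree : ∀ e → e ∈ˡ edges tree → Forest.EdgeIn tree tree-sym tree-irr tree-acyclic (allFin m) e
  edge-of-tree (i , j) e∈ with ∧-true (proj₂ (∈-select⁻ (is-edge tree) pairs e∈))
  ... | i<j , ij = <ᵇ-sound i<j , ij , ∈-allFin i , ∈-allFin j

  tree-edge-count : length (edges tree) ≤ m ∸ 1
  tree-edge-count = bound m refl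
    where
    bound : ∀ k → m ≡ k → length (edges tree) ≤ k ∸ 1
    bound zero m≡0 = unique-⊆-length (edges tree) [] (select-unique (is-edge tree) pairs-unique)
                       (λ e _ → ⊥-elim (no-vertex (subst Fin m≡0 (proj₁ e))))
      where no-vertex : Fin 0 → ⊥
            no-vertex ()
    bound (suc k) m≡ = Forest.forest-edges tree tree-sym tree-irr tree-acyclic k (allFin m)
                         (trans (List.length-tabulate {n = m} (λ i → i)) m≡) (Unique.allFin⁺ m)
                         (edges tree) (select-unique (is-edge tree) pairs-unique) edge-of-tree

  tree-edge-weight-3 : ∀ e → e ∈ˡ edges tree → 3 ≤ edge-weight e
  tree-edge-weight-3 e e∈ with 3 ≤? edge-weight e
  ... | yes 3≤ = 3≤
  ... | no 3≰ = ⊥-elim (<-irrefl refl (begin-strict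
      weight clique tree              ≡⟨ weight-as-sum tree ⟩
      sum (map edge-weight (edges tree)) <⟨ sum-< edge-weight 3 (edges tree) at-most-3 e e∈ (≰⇒> 3≰) ⟩
      3 * length (edges tree)         ≤⟨ *-monoʳ-≤ 3 tree-edge-count ⟩
      3 * (m ∸ 1)                     ≡⟨ sym T*-weight ⟩
      weight clique T*                ≤⟨ maxWeight T* T*-spanning ⟩
      weight clique tree              ∎))
    where
    open ≤-Reasoning
    at-most-3 : ∀ e → e ∈ˡ edges tree → edge-weight e ≤ 3
    at-most-3 (i , j) e∈ = ∩≤3 i j (adj⇒≢ tree tree-irr (proj₂ (∧-true (proj₂ (∈-select⁻ (is-edge tree) pairs e∈)))))

  listed : ∀ i j → toℕ i < toℕ j → Adj tree i j → (i , j) ∈ˡ edges tree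
  listed i j i<j ij = ∈-select⁺ (is-edge tree) (∈-pairs (i , j)) (subst (λ b → b ∧ tree i j ≡ true) (sym (<ᵇ-complete i<j)) ij)

  tree⊆T* : ∀ i j → Adj tree i j → Adj T* i j
  tree⊆T* i j ij with <-cmp (toℕ i) (toℕ j)
  ... | tri< i<j _ _ = ∩≥3⇒adj i j (tree-edge-weight-3 (i , j) (listed i j i<j ij)) (adj⇒≢ tree tree-irr ij)
  ... | tri≈ _ i≡j _ = ⊥-elim (adj⇒≢ tree tree-irr ij (toℕ-injective i≡j))
  ... | tri> _ _ j<i = trans (T*-sym i j) (∩≥3⇒adj j i (tree-edge-weight-3 (j , i) (listed j i j<i (trans (tree-sym j i) ij)))
                                                     (λ e → adj⇒≢ tree tree-irr ij (sym e)))

  -- Without the edge i — par i, the tree could not connect i to par i.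
  tree-to-parent : ∀ i → i ≢ root → Adj tree i (par i)
  tree-to-parent i i≢r with tree i (par i) in e
  ... | true = refl
  ... | false = ⊥-elim (not-desc-par i≢r (cut-subtree tree tree⊆T* i i≢r (λ a → false≢true (trans (sym e) a))
                                           (proj₂ (tree-connected i (par i))) dhere))
    where false≢true : false ≢ true
          false≢true ()

  T*⊆tree : ∀ i j → Adj T* i j → Adj tree i j
  T*⊆tree i j ij with T*-adj⁻ {i} {j} ij
  ... | inj₁ (i≢r , refl) = tree-to-parent i i≢r
  ... | inj₂ (j≢r , refl) = trans (tree-sym i j) (tree-to-parent j j≢r)

  tree≡T* : ∀ x y → tree x y ≡ T* x y
  tree≡T* x y with tree x y in e₁ | T* x y in e₂
  ... | true | true = refl
  ... | false | false = refl
  ... | true | false = trans (sym (tree⊆T* x y e₁)) e₂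
  ... | false | true = trans (sym e₁) (T*⊆tree x y e₂)

-- The RAN construction produces a clique structure

old-or-new : ∀ {n} (x : Fin (suc n)) → (∃[ y ] x ≡ inject₁ y) ⊎ x ≡ fromℕ n
old-or-new {zero} zero = inj₂ refl
old-or-new {suc n} zero = inj₁ (zero , refl)
old-or-new {suc n} (suc x) with old-or-new x
... | inj₁ (y , refl) = inj₁ (suc y , refl)
... | inj₂ refl = inj₂ refl

pred?-inject₁ : ∀ {n} (x : Fin n) → pred? (inject₁ x) ≡ just x
pred?-inject₁ {suc n} zero = refl
pred?-inject₁ {suc n} (suc x) rewrite pred?-inject₁ x = refl

pred?-fromℕ : ∀ n → pred? (fromℕ n) ≡ nothing
pred?-fromℕ zero = refl
pred?-fromℕ (suc n) rewrite pred?-fromℕ n = refl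

module _ {n} (E : Graph n) (f : Face n) where
  insert-old-old : ∀ x y → insertVertex E f (inject₁ x) (inject₁ y) ≡ E x y
  insert-old-old x y rewrite pred?-inject₁ x | pred?-inject₁ y = refl

  insert-old-new : ∀ x → insertVertex E f (inject₁ x) (fromℕ n) ≡ inFace f x
  insert-old-new x rewrite pred?-inject₁ x | pred?-fromℕ n = refl

  insert-new-old : ∀ x → insertVertex E f (fromℕ n) (inject₁ x) ≡ inFace f x
  insert-new-old x rewrite pred?-inject₁ x | pred?-fromℕ n = refl

∨-true⁻ : ∀ a b → a ∨ b ≡ true → a ≡ true ⊎ b ≡ true
∨-true⁻ true b _ = inj₁ refl
∨-true⁻ false b e = inj₂ e

∨-trueˡ : ∀ a b → a ≡ true → a ∨ b ≡ true
∨-trueˡ true b _ = refl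

∨-trueʳ : ∀ a b → b ≡ true → a ∨ b ≡ true
∨-trueʳ true b _ = refl
∨-trueʳ false b e = e

bool-ext : ∀ {u v : Bool} → (u ≡ true → v ≡ true) → (v ≡ true → u ≡ true) → u ≡ v
bool-ext {true} f g = sym (f refl)
bool-ext {false} {true} f g = g refl
bool-ext {false} {false} f g = refl

≟-inject₁ : ∀ {m} (x y : Fin m) → does (inject₁ x ≟ inject₁ y) ≡ does (x ≟ y)
≟-inject₁ x y with x ≟ y
... | yes refl = dec-true (inject₁ x ≟ inject₁ x) refl
... | no x≢y = dec-false (inject₁ x ≟ inject₁ y) (λ e → x≢y (inject₁-injective e))

≟-new-old : ∀ {m} (y : Fin m) → does (fromℕ m ≟ inject₁ y) ≡ false
≟-new-old {m} y = dec-false (fromℕ m ≟ inject₁ y) fromℕ≢inject₁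

≟-old-new : ∀ {m} (y : Fin m) → does (inject₁ y ≟ fromℕ m) ≡ false
≟-old-new {m} y = dec-false (inject₁ y ≟ fromℕ m) (λ e → fromℕ≢inject₁ (sym e))

Distinct3 : ∀ {n} → Face n → Set
Distinct3 (a , b , c) = a ≢ b × a ≢ c × b ≢ c

FaceIn : ∀ {n} → (Fin n → Bool) → Face n → Set
FaceIn k (a , b , c) = k a ≡ true × k b ≡ true × k c ≡ true

SameFace : ∀ {n} → Face n → Face n → Set
SameFace g h = ∀ x → inFace g x ≡ inFace h x

inFace⁻ : ∀ {n} (g : Face n) x → inFace g x ≡ true → x ≡ proj₁ g ⊎ x ≡ proj₁ (proj₂ g) ⊎ x ≡ proj₂ (proj₂ g)
inFace⁻ (a , b , c) x e with ∨-true⁻ (does (x ≟ a)) _ e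
... | inj₁ e₁ = inj₁ (does-true (x ≟ a) e₁)
... | inj₂ e₂ with ∨-true⁻ (does (x ≟ b)) _ e₂
... | inj₁ e₃ = inj₂ (inj₁ (does-true (x ≟ b) e₃))
... | inj₂ e₄ = inj₂ (inj₂ (does-true (x ≟ c) e₄))

inFace-a : ∀ {n} (g : Face n) → inFace g (proj₁ g) ≡ true
inFace-a (a , b , c) = ∨-trueˡ _ _ (dec-true (a ≟ a) refl)
inFace-b : ∀ {n} (g : Face n) → inFace g (proj₁ (proj₂ g)) ≡ true
inFace-b (a , b , c) = ∨-trueʳ (does (b ≟ a)) _ (∨-trueˡ _ _ (dec-true (b ≟ b) refl))
inFace-c : ∀ {n} (g : Face n) → inFace g (proj₂ (proj₂ g)) ≡ true
inFace-c (a , b , c) = ∨-trueʳ (does (c ≟ a)) _ (∨-trueʳ (does (c ≟ b)) _ (dec-true (c ≟ c) refl))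

FaceIn-∈ : ∀ {n} (k : Fin n → Bool) (g : Face n) → FaceIn k g → ∀ x → inFace g x ≡ true → k x ≡ true
FaceIn-∈ k g (ka , kb , kc) x e with inFace⁻ g x e
... | inj₁ refl = ka
... | inj₂ (inj₁ refl) = kb
... | inj₂ (inj₂ refl) = kc

inFace-inject₁ : ∀ {n} (g : Face n) x → inFace (injFace g) (inject₁ x) ≡ inFace g x
inFace-inject₁ (a , b , c) x rewrite ≟-inject₁ x a | ≟-inject₁ x b | ≟-inject₁ x c = refl

inFace-new : ∀ {n} (g : Face n) → inFace (injFace g) (fromℕ n) ≡ false
inFace-new (a , b , c) rewrite ≟-new-old a | ≟-new-old b | ≟-new-old c = refl

inFace-outside : ∀ {m} (g : Face m) x → x ≢ proj₁ g → x ≢ proj₁ (proj₂ g) → x ≢ proj₂ (proj₂ g) → inFace g x ≡ false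
inFace-outside (u , v , t) x x≢u x≢v x≢t
  rewrite dec-false (x ≟ u) x≢u | dec-false (x ≟ v) x≢v | dec-false (x ≟ t) x≢t = refl

different-faces : ∀ {m} (g h : Face m) x → inFace g x ≡ true → inFace h x ≡ false → ¬ SameFace g h
different-faces g h x gx hx same with trans (sym gx) (trans (same x) hx)
... | ()

face-⊆ : ∀ {n} (g f : Face n) → Distinct3 g → (∀ x → inFace g x ≡ true → inFace f x ≡ true) →
         ∀ v → inFace f v ≡ true → inFace g v ≡ true
face-⊆ g@(x , y , z) f@(a , b , c) (x≢y , x≢z , y≢z) g⊆f v v∈f with inFace g v in v∉g
... | true = refl
... | false = ⊥-elim (<-irrefl refl (unique-⊆-length (v ∷ x ∷ y ∷ z ∷ []) (a ∷ b ∷ c ∷ []) four-distinct four-in-f))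
  where
  v≢ : ∀ u → inFace g u ≡ true → v ≢ u
  v≢ u u∈g refl with trans (sym v∉g) u∈g
  ... | ()
  four-distinct : Unique (v ∷ x ∷ y ∷ z ∷ [])
  four-distinct = (v≢ x (inFace-a g) ∷ v≢ y (inFace-b g) ∷ v≢ z (inFace-c g) ∷ []) ∷ (x≢y ∷ x≢z ∷ []) ∷ (y≢z ∷ []) ∷ [] ∷ []
  corner : ∀ u → inFace f u ≡ true → u ∈ˡ (a ∷ b ∷ c ∷ [])
  corner u u∈f with inFace⁻ f u u∈f
  ... | inj₁ refl = here refl
  ... | inj₂ (inj₁ refl) = there (here refl)
  ... | inj₂ (inj₂ refl) = there (there (here refl))
  four-in-f : ∀ u → u ∈ˡ (v ∷ x ∷ y ∷ z ∷ []) → u ∈ˡ (a ∷ b ∷ c ∷ [])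
  four-in-f u (here refl) = corner v v∈f
  four-in-f u (there (here refl)) = corner x (g⊆f x (inFace-a g))
  four-in-f u (there (there (here refl))) = corner y (g⊆f y (inFace-b g))
  four-in-f u (there (there (there (here refl)))) = corner z (g⊆f z (inFace-c g))

∈-─ : ∀ {x y : A} (xs : List A) (p : x ∈ˡ xs) → y ∈ˡ (xs ─ p) → y ∈ˡ xs
∈-─ (z ∷ xs) (here _) y∈ = there y∈
∈-─ (z ∷ xs) (there p) (here e) = here e
∈-─ (z ∷ xs) (there p) (there y∈) = there (∈-─ xs p y∈)

AllPairs-─ : ∀ {R : A → A → Set} {x : A} (xs : List A) → AllPairs R xs → (p : x ∈ˡ xs) → AllPairs R (xs ─ p)
AllPairs-─ (z ∷ xs) (_ ∷ ap) (here _) = ap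
AllPairs-─ (z ∷ xs) (az ∷ ap) (there p) = ─⁺ p az ∷ AllPairs-─ xs ap p

AllPairs-removed : ∀ {R : A → A → Set} {x y : A} (xs : List A) → AllPairs R xs → (p : x ∈ˡ xs) → y ∈ˡ (xs ─ p) → R x y ⊎ R y x
AllPairs-removed (z ∷ xs) (az ∷ ap) (here refl) y∈ = inj₁ (All.lookup az y∈)
AllPairs-removed (z ∷ xs) (az ∷ ap) (there p) (here refl) = inj₂ (All.lookup az p)
AllPairs-removed (z ∷ xs) (az ∷ ap) (there p) (there y∈) = AllPairs-removed xs ap p y∈

member : ∀ {n M} → (Fin M → Fin n) → (Fin M → Face n) → Fin M → Fin n → Bool
member ν fc i x = does (x ≟ ν i) ∨ inFace (fc i) x

-- The invariant of a construction state (graph E, bounded faces F) with M cliques, in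
-- Boolean form: clique i is the new vertex ν i with the face fc i it was inserted into.
record RANInvariant {n : ℕ} (M : ℕ) (E : Graph n) (F : List (Face n)) : Set where
  field
    ν : Fin M → Fin n
    fc : Fin M → Face n
    par : Fin M → Fin M
    root : Fin M
    par-< : ∀ i → i ≢ root → toℕ (par i) < toℕ i
    fc-distinct : ∀ i → Distinct3 (fc i)
    ν∉fc : ∀ i → inFace (fc i) (ν i) ≡ false
    face-in-par : ∀ i → i ≢ root → FaceIn (member ν fc (par i)) (fc i)
    new-in-subtree : ∀ i z → member ν fc z (ν i) ≡ true → ParentTree.Desc toℕ root par par-< i z
    clique : ∀ i x y → member ν fc i x ≡ true → member ν fc i y ≡ true → x ≢ y → E x y ≡ true
    cover : ∀ (C : Fin n → Bool) → (∀ x y → C x ≡ true → C y ≡ true → x ≢ y → E x y ≡ true) →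
            ∃[ i ] (∀ x → C x ≡ true → member ν fc i x ≡ true)
    share3 : ∀ i j (g : Face n) → Distinct3 g → FaceIn (member ν fc i) g → FaceIn (member ν fc j) g → i ≢ j →
             (j ≢ root × i ≡ par j) ⊎ (i ≢ root × j ≡ par i)
    E-sym : Symmetric E
    face-owner : ∀ g → g ∈ˡ F → Distinct3 g × ∃[ o ] (FaceIn (member ν fc o) g × ∀ i → FaceIn (member ν fc i) g → i ≡ o)
    faces-distinct : AllPairs (λ g h → ¬ SameFace g h) F

-- Inserting a vertex into the bounded face f = (a , b , c) preserves the invariant: the
-- new clique is f plus the new vertex, and its parent is the unique clique owning f.
module Insertion {n M : ℕ} {E : Graph n} {F : List (Face n)} (I : RANInvariant M E F)
                 {a b c : Fin n} (f∈F : (a , b , c) ∈ˡ F) where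
  open RANInvariant I

  f : Face n
  f = a , b , c

  K : Fin M → Fin n → Bool
  K = member ν fc

  f-distinct : Distinct3 f
  f-distinct = proj₁ (face-owner f f∈F)
  owner : Fin M
  owner = proj₁ (proj₂ (face-owner f f∈F))
  f-in-owner : FaceIn (K owner) f
  f-in-owner = proj₁ (proj₂ (proj₂ (face-owner f f∈F)))
  owner-unique : ∀ i → FaceIn (K i) f → i ≡ owner
  owner-unique = proj₂ (proj₂ (proj₂ (face-owner f f∈F)))

  new : Fin (suc n)
  new = fromℕ n
  newQ : Fin (suc M)
  newQ = fromℕ M

  -- Old cliques keep their data; the new clique newQ has vertex new, face f, parent owner.
  ν′ : Fin (suc M) → Fin (suc n)
  ν′ j = maybe (λ i → inject₁ (ν i)) new (pred? j)
  fc′ : Fin (suc M) → Face (suc n)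
  fc′ j = maybe (λ i → injFace (fc i)) (injFace f) (pred? j)
  par′ : Fin (suc M) → Fin (suc M)
  par′ j = maybe (λ i → inject₁ (par i)) (inject₁ owner) (pred? j)
  root′ : Fin (suc M)
  root′ = inject₁ root

  ν′-old : ∀ i → ν′ (inject₁ i) ≡ inject₁ (ν i)
  ν′-old i rewrite pred?-inject₁ i = refl
  ν′-new : ν′ newQ ≡ new
  ν′-new rewrite pred?-fromℕ M = refl
  fc′-old : ∀ i → fc′ (inject₁ i) ≡ injFace (fc i)
  fc′-old i rewrite pred?-inject₁ i = refl
  fc′-new : fc′ newQ ≡ injFace f
  fc′-new rewrite pred?-fromℕ M = refl
  par′-old : ∀ i → par′ (inject₁ i) ≡ inject₁ (par i)
  par′-old i rewrite pred?-inject₁ i = refl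
  par′-new : par′ newQ ≡ inject₁ owner
  par′-new rewrite pred?-fromℕ M = refl

  K′ : Fin (suc M) → Fin (suc n) → Bool
  K′ = member ν′ fc′

  K′-old-old : ∀ i x → K′ (inject₁ i) (inject₁ x) ≡ K i x
  K′-old-old i x rewrite ν′-old i | fc′-old i | ≟-inject₁ x (ν i) | inFace-inject₁ (fc i) x = refl
  K′-old-new : ∀ i → K′ (inject₁ i) new ≡ false
  K′-old-new i rewrite ν′-old i | fc′-old i | ≟-new-old (ν i) | inFace-new (fc i) = refl
  K′-new-old : ∀ x → K′ newQ (inject₁ x) ≡ inFace f x
  K′-new-old x rewrite ν′-new | fc′-new | ≟-old-new x | inFace-inject₁ f x = refl
  K′-new-new : K′ newQ new ≡ true
  K′-new-new rewrite ν′-new = ∨-trueˡ _ _ (dec-true (new ≟ new) refl)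

  new≢old : ∀ {m} (i : Fin m) → fromℕ m ≢ inject₁ i
  new≢old i = fromℕ≢inject₁

  ≢-inject₁ : ∀ {m} {x y : Fin m} → x ≢ y → inject₁ x ≢ inject₁ y
  ≢-inject₁ x≢y e = x≢y (inject₁-injective e)

  par′-< : ∀ i → i ≢ root′ → toℕ (par′ i) < toℕ i
  par′-< j j≢r with old-or-new j
  ... | inj₁ (i , refl) rewrite par′-old i | toℕ-inject₁ (par i) | toℕ-inject₁ i = par-< i (λ e → j≢r (cong inject₁ e))
  ... | inj₂ refl rewrite par′-new | toℕ-inject₁ owner | toℕ-fromℕ M = toℕ<n owner

  module Old = ParentTree toℕ root par par-<
  module New = ParentTree toℕ root′ par′ par′-<

  desc-old : ∀ {i j} → Old.Desc i j → New.Desc (inject₁ i) (inject₁ j)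
  desc-old Old.dhere = New.dhere
  desc-old (Old.dup {j} j≢r d) = New.dup (≢-inject₁ j≢r) (subst (New.Desc _) (sym (par′-old j)) (desc-old d))

  E′ : Graph (suc n)
  E′ = insertVertex E f

  Distinct3-inject₁ : ∀ (g : Face n) → Distinct3 g → Distinct3 (injFace g)
  Distinct3-inject₁ g (p₁ , p₂ , p₃) = ≢-inject₁ p₁ , ≢-inject₁ p₂ , ≢-inject₁ p₃

  Distinct3-inject₁⁻ : ∀ (g : Face n) → Distinct3 (injFace g) → Distinct3 g
  Distinct3-inject₁⁻ g (p₁ , p₂ , p₃) = (λ e → p₁ (cong inject₁ e)) , (λ e → p₂ (cong inject₁ e)) , (λ e → p₃ (cong inject₁ e))

  FaceIn-old : ∀ j (g : Face n) → FaceIn (K j) g → FaceIn (K′ (inject₁ j)) (injFace g)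
  FaceIn-old j (x , y , z) (kx , ky , kz) = trans (K′-old-old j x) kx , trans (K′-old-old j y) ky , trans (K′-old-old j z) kz

  FaceIn-old⁻ : ∀ j (g : Face n) → FaceIn (K′ (inject₁ j)) (injFace g) → FaceIn (K j) g
  FaceIn-old⁻ j (x , y , z) (kx , ky , kz) =
    trans (sym (K′-old-old j x)) kx , trans (sym (K′-old-old j y)) ky , trans (sym (K′-old-old j z)) kz

  FaceIn-new⁻ : ∀ (g : Face n) → FaceIn (K′ newQ) (injFace g) → FaceIn (inFace f) g
  FaceIn-new⁻ (x , y , z) (kx , ky , kz) = trans (sym (K′-new-old x)) kx , trans (sym (K′-new-old y)) ky , trans (sym (K′-new-old z)) kz

  old-face : ∀ i (g : Face (suc n)) → FaceIn (K′ (inject₁ i)) g → Σ (Face n) λ g′ → g ≡ injFace g′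
  old-face i (x , y , z) (kx , ky , kz) with old-or-new x | old-or-new y | old-or-new z
  ... | inj₂ refl | _ | _ with trans (sym (K′-old-new i)) kx
  ... | ()
  old-face i (x , y , z) (kx , ky , kz) | inj₁ _ | inj₂ refl | _ with trans (sym (K′-old-new i)) ky
  ... | ()
  old-face i (x , y , z) (kx , ky , kz) | inj₁ _ | inj₁ _ | inj₂ refl with trans (sym (K′-old-new i)) kz
  ... | ()
  old-face i (x , y , z) _ | inj₁ (x′ , refl) | inj₁ (y′ , refl) | inj₁ (z′ , refl) = (x′ , y′ , z′) , refl

  inside-f⇒owner : ∀ i (g : Face n) → Distinct3 g → FaceIn (K i) g → FaceIn (inFace f) g → i ≡ owner
  inside-f⇒owner i g g-distinct g-in-i g-in-f = owner-unique i (in-i a (inFace-a f) , in-i b (inFace-b f) , in-i c (inFace-c f))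
    where
    in-i : ∀ x → inFace f x ≡ true → K i x ≡ true
    in-i x x∈f = FaceIn-∈ (K i) g g-in-i x (face-⊆ g f g-distinct (FaceIn-∈ (inFace f) g g-in-f) x x∈f)

  fc′-distinct : ∀ j → Distinct3 (fc′ j)
  fc′-distinct j with old-or-new j
  ... | inj₁ (i , refl) rewrite fc′-old i = Distinct3-inject₁ (fc i) (fc-distinct i)
  ... | inj₂ refl rewrite fc′-new = Distinct3-inject₁ f f-distinct

  ν′∉fc′ : ∀ j → inFace (fc′ j) (ν′ j) ≡ false
  ν′∉fc′ j with old-or-new j
  ... | inj₁ (i , refl) rewrite fc′-old i | ν′-old i | inFace-inject₁ (fc i) (ν i) = ν∉fc i
  ... | inj₂ refl rewrite fc′-new | ν′-new = inFace-new f

  face-in-par′ : ∀ j → j ≢ root′ → FaceIn (K′ (par′ j)) (fc′ j)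
  face-in-par′ j j≢r with old-or-new j
  ... | inj₁ (i , refl) rewrite fc′-old i | par′-old i = FaceIn-old (par i) (fc i) (face-in-par i (λ e → j≢r (cong inject₁ e)))
  ... | inj₂ refl rewrite fc′-new | par′-new = FaceIn-old owner f f-in-owner

  new-in-subtree′ : ∀ i z → K′ z (ν′ i) ≡ true → New.Desc i z
  new-in-subtree′ i′ z′ ν∈z with old-or-new i′ | old-or-new z′
  ... | inj₁ (i , refl) | inj₁ (z , refl) rewrite ν′-old i =
    desc-old (new-in-subtree i z (trans (sym (K′-old-old z (ν i))) ν∈z))
  ... | inj₁ (i , refl) | inj₂ refl rewrite ν′-old i =
    New.dup (new≢old root) (subst (New.Desc _) (sym par′-new)
      (desc-old (new-in-subtree i owner (FaceIn-∈ (K owner) f f-in-owner (ν i) (trans (sym (K′-new-old (ν i))) ν∈z)))))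
  ... | inj₂ refl | inj₁ (z , refl) rewrite ν′-new with trans (sym (K′-old-new z)) ν∈z
  ... | ()
  new-in-subtree′ i′ z′ ν∈z | inj₂ refl | inj₂ refl = New.dhere

  clique′ : ∀ j x y → K′ j x ≡ true → K′ j y ≡ true → x ≢ y → E′ x y ≡ true
  clique′ j x y x∈ y∈ x≢y with old-or-new j | old-or-new x | old-or-new y
  ... | inj₁ (i , refl) | inj₂ refl | _ with trans (sym (K′-old-new i)) x∈
  ... | ()
  clique′ j x y x∈ y∈ x≢y | inj₁ (i , refl) | inj₁ _ | inj₂ refl with trans (sym (K′-old-new i)) y∈
  ... | ()
  clique′ j x y x∈ y∈ x≢y | inj₁ (i , refl) | inj₁ (x′ , refl) | inj₁ (y′ , refl) =
    trans (insert-old-old E f x′ y′)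
          (clique i x′ y′ (trans (sym (K′-old-old i x′)) x∈) (trans (sym (K′-old-old i y′)) y∈) (λ e → x≢y (cong inject₁ e)))
  clique′ j x y x∈ y∈ x≢y | inj₂ refl | inj₁ (x′ , refl) | inj₁ (y′ , refl) =
    trans (insert-old-old E f x′ y′)
          (clique owner x′ y′ (FaceIn-∈ (K owner) f f-in-owner x′ (trans (sym (K′-new-old x′)) x∈))
                              (FaceIn-∈ (K owner) f f-in-owner y′ (trans (sym (K′-new-old y′)) y∈)) (λ e → x≢y (cong inject₁ e)))
  clique′ j x y x∈ y∈ x≢y | inj₂ refl | inj₁ (x′ , refl) | inj₂ refl = trans (insert-old-new E f x′) (trans (sym (K′-new-old x′)) x∈)
  clique′ j x y x∈ y∈ x≢y | inj₂ refl | inj₂ refl | inj₁ (y′ , refl) = trans (insert-new-old E f y′) (trans (sym (K′-new-old y′)) y∈)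
  clique′ j x y x∈ y∈ x≢y | inj₂ refl | inj₂ refl | inj₂ refl = ⊥-elim (x≢y refl)

  -- a clique through the new vertex lies in the new clique; otherwise it is an old clique
  cover′ : ∀ (C : Fin (suc n) → Bool) → (∀ x y → C x ≡ true → C y ≡ true → x ≢ y → E′ x y ≡ true) →
           ∃[ i ] (∀ x → C x ≡ true → K′ i x ≡ true)
  cover′ C C-clique with C new in new∈C
  ... | true = newQ , in-new
    where
    in-new : ∀ x → C x ≡ true → K′ newQ x ≡ true
    in-new x x∈C with old-or-new x
    ... | inj₂ refl = K′-new-new
    ... | inj₁ (x′ , refl) = trans (K′-new-old x′) (trans (sym (insert-old-new E f x′))
                                                          (C-clique _ _ x∈C new∈C (λ e → new≢old x′ (sym e))))
  ... | false with cover (λ x → C (inject₁ x)) (λ x y x∈ y∈ x≢y → trans (sym (insert-old-old E f x y)) (C-clique _ _ x∈ y∈ (≢-inject₁ x≢y)))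
  ... | i , C⊆i = inject₁ i , in-old
    where
    in-old : ∀ x → C x ≡ true → K′ (inject₁ i) x ≡ true
    in-old x x∈C with old-or-new x
    ... | inj₂ refl with trans (sym new∈C) x∈C
    ... | ()
    in-old x x∈C | inj₁ (x′ , refl) = trans (K′-old-old i x′) (C⊆i x′ x∈C)

  share3′ : ∀ i j (g : Face (suc n)) → Distinct3 g → FaceIn (K′ i) g → FaceIn (K′ j) g → i ≢ j →
            (j ≢ root′ × i ≡ par′ j) ⊎ (i ≢ root′ × j ≡ par′ i)
  share3′ i′ j′ g g-distinct g-in-i g-in-j i≢j with old-or-new i′ | old-or-new j′
  ... | inj₂ refl | inj₂ refl = ⊥-elim (i≢j refl)
  ... | inj₁ (i , refl) | inj₁ (j , refl) with old-face i g g-in-i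
  ... | g′ , refl with share3 i j g′ (Distinct3-inject₁⁻ g′ g-distinct) (FaceIn-old⁻ i g′ g-in-i) (FaceIn-old⁻ j g′ g-in-j)
                              (λ e → i≢j (cong inject₁ e))
  ... | inj₁ (j≢r , e) = inj₁ (≢-inject₁ j≢r , trans (cong inject₁ e) (sym (par′-old j)))
  ... | inj₂ (i≢r , e) = inj₂ (≢-inject₁ i≢r , trans (cong inject₁ e) (sym (par′-old i)))
  share3′ i′ j′ g g-distinct g-in-i g-in-j i≢j | inj₁ (i , refl) | inj₂ refl with old-face i g g-in-i
  ... | g′ , refl = inj₁ (new≢old root , trans (cong inject₁ (inside-f⇒owner i g′ (Distinct3-inject₁⁻ g′ g-distinct)
                                                   (FaceIn-old⁻ i g′ g-in-i) (FaceIn-new⁻ g′ g-in-j))) (sym par′-new))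
  share3′ i′ j′ g g-distinct g-in-i g-in-j i≢j | inj₂ refl | inj₁ (j , refl) with old-face j g g-in-j
  ... | g′ , refl = inj₂ (new≢old root , trans (cong inject₁ (inside-f⇒owner j g′ (Distinct3-inject₁⁻ g′ g-distinct)
                                                   (FaceIn-old⁻ j g′ g-in-j) (FaceIn-new⁻ g′ g-in-i))) (sym par′-new))

  E′-sym : Symmetric E′
  E′-sym x y with old-or-new x | old-or-new y
  ... | inj₁ (x′ , refl) | inj₁ (y′ , refl) rewrite insert-old-old E f x′ y′ | insert-old-old E f y′ x′ = E-sym x′ y′
  ... | inj₁ (x′ , refl) | inj₂ refl rewrite insert-old-new E f x′ | insert-new-old E f x′ = refl
  ... | inj₂ refl | inj₁ (y′ , refl) rewrite insert-old-new E f y′ | insert-new-old E f y′ = refl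
  ... | inj₂ refl | inj₂ refl = refl

  F′ : List (Face (suc n))
  F′ = (inject₁ a , inject₁ b , fromℕ n) ∷ (inject₁ a , inject₁ c , fromℕ n) ∷ (inject₁ b , inject₁ c , fromℕ n) ∷ map injFace (F ─ f∈F)

  new-face-owner : ∀ x y → x ≢ y → inFace f x ≡ true → inFace f y ≡ true →
    Distinct3 (inject₁ x , inject₁ y , new) × ∃[ o ] (FaceIn (K′ o) (inject₁ x , inject₁ y , new) ×
                                                      ∀ i → FaceIn (K′ i) (inject₁ x , inject₁ y , new) → i ≡ o)
  new-face-owner x y x≢y x∈f y∈f =
    (≢-inject₁ x≢y , (λ e → new≢old x (sym e)) , (λ e → new≢old y (sym e))) ,
    newQ , (trans (K′-new-old x) x∈f , trans (K′-new-old y) y∈f , K′-new-new) , only-newQ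
    where
    only-newQ : ∀ i → FaceIn (K′ i) (inject₁ x , inject₁ y , new) → i ≡ newQ
    only-newQ i (_ , _ , new∈i) with old-or-new i
    ... | inj₂ refl = refl
    ... | inj₁ (i′ , refl) with trans (sym (K′-old-new i′)) new∈i
    ... | ()

  -- an old face keeps its owner: it cannot lie in the new clique, as it differs from f
  face-owner′ : ∀ g → g ∈ˡ F′ → Distinct3 g × ∃[ o ] (FaceIn (K′ o) g × ∀ i → FaceIn (K′ i) g → i ≡ o)
  face-owner′ g (here refl) = new-face-owner a b (proj₁ f-distinct) (inFace-a f) (inFace-b f)
  face-owner′ g (there (here refl)) = new-face-owner a c (proj₁ (proj₂ f-distinct)) (inFace-a f) (inFace-c f)
  face-owner′ g (there (there (here refl))) = new-face-owner b c (proj₂ (proj₂ f-distinct)) (inFace-b f) (inFace-c f)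
  face-owner′ g (there (there (there g∈))) with ∈-map⁻ injFace g∈
  ... | g′ , g′∈ , refl with face-owner g′ (∈-─ F f∈F g′∈)
  ... | g′-distinct , o , g′-in-o , o-unique = Distinct3-inject₁ g′ g′-distinct , inject₁ o , FaceIn-old o g′ g′-in-o , unique
    where
    unique : ∀ i → FaceIn (K′ i) (injFace g′) → i ≡ inject₁ o
    unique i g′-in-i with old-or-new i
    ... | inj₁ (i′ , refl) = cong inject₁ (o-unique i′ (FaceIn-old⁻ i′ g′ g′-in-i))
    ... | inj₂ refl = ⊥-elim ([ (λ ¬same → ¬same (λ x → sym (same x))) , (λ ¬same → ¬same same) ]
                               (AllPairs-removed F faces-distinct f∈F g′∈))
      where
      g′-in-f : FaceIn (inFace f) g′
      g′-in-f = FaceIn-new⁻ g′ g′-in-i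
      same : SameFace g′ f
      same x = bool-ext (FaceIn-∈ (inFace f) g′ g′-in-f x) (face-⊆ g′ f g′-distinct (FaceIn-∈ (inFace f) g′ g′-in-f) x)

  -- new faces contain the new vertex, old ones do not; the old ones stay distinct
  faces-distinct′ : AllPairs (λ g h → ¬ SameFace g h) F′
  faces-distinct′ = (ab≠ac ∷ ab≠bc ∷ old-differ a b) ∷ (ac≠bc ∷ old-differ a c) ∷ old-differ b c
                  ∷ AllPairs.map⁺ (AllPairs.map ≠-inject₁ (AllPairs-─ F faces-distinct f∈F))
    where
    a≢b : a ≢ b
    a≢b = proj₁ f-distinct
    a≢c : a ≢ c
    a≢c = proj₁ (proj₂ f-distinct)
    b≢c : b ≢ c
    b≢c = proj₂ (proj₂ f-distinct)
    ab≠ac : ¬ SameFace (inject₁ a , inject₁ b , new) (inject₁ a , inject₁ c , new)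
    ab≠ac = different-faces _ _ (inject₁ b) (inFace-b (inject₁ a , inject₁ b , new))
              (inFace-outside (inject₁ a , inject₁ c , new) (inject₁ b) (λ e → a≢b (sym (inject₁-injective e))) (≢-inject₁ b≢c) (new≢old b ∘ sym))
    ab≠bc : ¬ SameFace (inject₁ a , inject₁ b , new) (inject₁ b , inject₁ c , new)
    ab≠bc = different-faces _ _ (inject₁ a) (inFace-a (inject₁ a , inject₁ b , new))
              (inFace-outside (inject₁ b , inject₁ c , new) (inject₁ a) (≢-inject₁ a≢b) (≢-inject₁ a≢c) (new≢old a ∘ sym))
    ac≠bc : ¬ SameFace (inject₁ a , inject₁ c , new) (inject₁ b , inject₁ c , new)
    ac≠bc = different-faces _ _ (inject₁ a) (inFace-a (inject₁ a , inject₁ c , new))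
              (inFace-outside (inject₁ b , inject₁ c , new) (inject₁ a) (≢-inject₁ a≢b) (≢-inject₁ a≢c) (new≢old a ∘ sym))
    old-differ : ∀ (x y : Fin n) → All (λ h → ¬ SameFace (inject₁ x , inject₁ y , new) h) (map injFace (F ─ f∈F))
    old-differ x y = All-map⁺ (All.tabulate λ {h} _ → different-faces _ _ new (inFace-c (inject₁ x , inject₁ y , new)) (inFace-new h))
    ≠-inject₁ : ∀ {g h : Face n} → ¬ SameFace g h → ¬ SameFace (injFace g) (injFace h)
    ≠-inject₁ {g} {h} ¬same same = ¬same λ x → trans (sym (inFace-inject₁ g x)) (trans (same (inject₁ x)) (inFace-inject₁ h x))

  invariant′ : RANInvariant (suc M) E′ F′
  invariant′ = record
    { ν = ν′ ; fc = fc′ ; par = par′ ; root = root′ ; par-< = par′-< ; fc-distinct = fc′-distinct ; ν∉fc = ν′∉fc′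
    ; face-in-par = face-in-par′ ; new-in-subtree = new-in-subtree′ ; clique = clique′ ; cover = cover′
    ; share3 = share3′ ; E-sym = E′-sym ; face-owner = face-owner′ ; faces-distinct = faces-distinct′ }

-- The first insertion turns the triangle into K₄, a single clique.
module K₄ where
  E₄ : Graph 4
  E₄ = insertVertex triangle (zero , suc zero , suc (suc zero))

  F₄ : List (Face 4)
  F₄ = (inject₁ zero , inject₁ (suc zero) , fromℕ 3) ∷ (inject₁ zero , inject₁ (suc (suc zero)) , fromℕ 3)
     ∷ (inject₁ (suc zero) , inject₁ (suc (suc zero)) , fromℕ 3) ∷ []

  E₄-complete : ∀ x y → E₄ x y ≡ not (does (x ≟ y))
  E₄-complete zero zero = refl
  E₄-complete zero (suc zero) = refl
  E₄-complete zero (suc (suc zero)) = refl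
  E₄-complete zero (suc (suc (suc zero))) = refl
  E₄-complete (suc zero) zero = refl
  E₄-complete (suc zero) (suc zero) = refl
  E₄-complete (suc zero) (suc (suc zero)) = refl
  E₄-complete (suc zero) (suc (suc (suc zero))) = refl
  E₄-complete (suc (suc zero)) zero = refl
  E₄-complete (suc (suc zero)) (suc zero) = refl
  E₄-complete (suc (suc zero)) (suc (suc zero)) = refl
  E₄-complete (suc (suc zero)) (suc (suc (suc zero))) = refl
  E₄-complete (suc (suc (suc zero))) zero = refl
  E₄-complete (suc (suc (suc zero))) (suc zero) = refl
  E₄-complete (suc (suc (suc zero))) (suc (suc zero)) = refl
  E₄-complete (suc (suc (suc zero))) (suc (suc (suc zero))) = refl

  ν₄ : Fin 1 → Fin 4
  ν₄ _ = fromℕ 3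
  fc₄ : Fin 1 → Face 4
  fc₄ _ = zero , suc zero , suc (suc zero)

  -- every vertex lies in the single clique, so every face is owned by it
  member-all : ∀ i x → member ν₄ fc₄ i x ≡ true
  member-all zero zero = refl
  member-all zero (suc zero) = refl
  member-all zero (suc (suc zero)) = refl
  member-all zero (suc (suc (suc zero))) = refl

  only-clique : ∀ (i : Fin 1) → i ≡ zero
  only-clique zero = refl

  does-sym : ∀ (x y : Fin 4) → does (x ≟ y) ≡ does (y ≟ x)
  does-sym x y with x ≟ y | y ≟ x
  ... | yes _ | yes _ = refl
  ... | no _ | no _ = refl
  ... | yes e | no ne = ⊥-elim (ne (sym e))
  ... | no ne | yes e = ⊥-elim (ne (sym e))

  true≢false : true ≢ false
  true≢false ()

  owned : ∀ g → Distinct3 g → Distinct3 g × ∃[ o ] (FaceIn (member ν₄ fc₄ o) g × ∀ i → FaceIn (member ν₄ fc₄ i) g → i ≡ o)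
  owned (x , y , z) d = d , zero , (member-all zero x , member-all zero y , member-all zero z) , λ i _ → only-clique i

  invariant : RANInvariant 1 E₄ F₄
  invariant = record
    { ν = ν₄ ; fc = fc₄ ; par = λ _ → zero ; root = zero ; par-< = λ { zero z≢z → ⊥-elim (z≢z refl) }
    ; fc-distinct = λ _ → (λ ()) , (λ ()) , (λ ())
    ; ν∉fc = λ { zero → refl }
    ; face-in-par = λ { zero z≢z → ⊥-elim (z≢z refl) }
    ; new-in-subtree = λ { zero zero _ → ParentTree.dhere }
    ; clique = λ i x y _ _ x≢y → trans (E₄-complete x y) (cong not (dec-false (x ≟ y) x≢y))
    ; cover = λ C _ → zero , λ x _ → member-all zero x
    ; share3 = λ { zero zero g _ _ _ z≢z → ⊥-elim (z≢z refl) }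
    ; E-sym = λ x y → trans (E₄-complete x y) (trans (cong not (does-sym x y)) (sym (E₄-complete y x)))
    ; face-owner = λ { g (here refl) → owned g ((λ ()) , (λ ()) , (λ ()))
                     ; g (there (here refl)) → owned g ((λ ()) , (λ ()) , (λ ()))
                     ; g (there (there (here refl))) → owned g ((λ ()) , (λ ()) , (λ ())) }
    ; faces-distinct = ((λ same → true≢false (same (suc zero))) ∷ (λ same → true≢false (same zero)) ∷ [])
                     ∷ ((λ same → true≢false (same zero)) ∷ []) ∷ [] ∷ [] }

ran-size≥3 : ∀ {n E F} → RANState n E F → 3 ≤ n
ran-size≥3 start = s≤s (s≤s (s≤s z≤n))
ran-size≥3 (insert s _) = m≤n⇒m≤1+n (ran-size≥3 s)

ran-size-3 : ∀ {E F} → RANState 3 E F → E ≡ triangle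
ran-size-3 start = refl
ran-size-3 (insert s _) with ran-size≥3 s
... | s≤s (s≤s ())

invariant-of : ∀ {k E F} → RANState (suc (suc (suc (suc k)))) E F → RANInvariant (suc k) E F
invariant-of {zero} (insert start (here refl)) = K₄.invariant
invariant-of {zero} (insert (insert s _) _) with ran-size≥3 s
... | s≤s (s≤s ())
invariant-of {suc k} (insert s p) = Insertion.invariant′ (invariant-of s) p

module FromInvariant {n M : ℕ} {E : Graph n} {F : List (Face n)} (I : RANInvariant M E F) where
  open RANInvariant I

  Q : Fin M → Subset n
  Q i = tabulate (member ν fc i)

  fa fb fc₃ : Fin M → Fin n
  fa i = proj₁ (fc i)
  fb i = proj₁ (proj₂ (fc i))
  fc₃ i = proj₂ (proj₂ (fc i))

  ν≢ : ∀ i x → inFace (fc i) x ≡ true → ν i ≢ x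
  ν≢ i x x∈ refl with trans (sym (ν∉fc i)) x∈
  ... | ()

  quad⊆Q′ : ∀ i x → x ∈ˡ quad ν fa fb fc₃ i → x ∈ Q i
  quad⊆Q′ i x x∈ = ∈-tabulate⁺ (member ν fc i) x (in-member x∈)
    where
    in-member : x ∈ˡ quad ν fa fb fc₃ i → member ν fc i x ≡ true
    in-member (here refl) = ∨-trueˡ _ _ (dec-true (x ≟ x) refl)
    in-member (there (here refl)) = ∨-trueʳ (does (x ≟ ν i)) _ (inFace-a (fc i))
    in-member (there (there (here refl))) = ∨-trueʳ (does (x ≟ ν i)) _ (inFace-b (fc i))
    in-member (there (there (there (here refl)))) = ∨-trueʳ (does (x ≟ ν i)) _ (inFace-c (fc i))

  Q⊆quad′ : ∀ i x → x ∈ Q i → x ∈ˡ quad ν fa fb fc₃ i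
  Q⊆quad′ i x x∈ with ∨-true⁻ (does (x ≟ ν i)) _ (∈-tabulate⁻ (member ν fc i) x x∈)
  ... | inj₁ e = here (does-true (x ≟ ν i) e)
  ... | inj₂ e with inFace⁻ (fc i) x e
  ... | inj₁ e′ = there (here e′)
  ... | inj₂ (inj₁ e′) = there (there (here e′))
  ... | inj₂ (inj₂ e′) = there (there (there (here e′)))

  structure : CliqueStructure E M Q
  structure = record
    { rank = toℕ ; root = root ; par = par ; par-< = par-<
    ; ν = ν ; fa = fa ; fb = fb ; fc = fc₃
    ; distinct = λ i → (ν≢ i _ (inFace-a (fc i)) ∷ ν≢ i _ (inFace-b (fc i)) ∷ ν≢ i _ (inFace-c (fc i)) ∷ [])
                     ∷ (proj₁ (fc-distinct i) ∷ proj₁ (proj₂ (fc-distinct i)) ∷ []) ∷ (proj₂ (proj₂ (fc-distinct i)) ∷ []) ∷ [] ∷ []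
    ; quad⊆Q = quad⊆Q′ ; Q⊆quad = Q⊆quad′
    ; face-in-par = λ i i≢r → let (ka , kb , kc) = face-in-par i i≢r in ∈-tabulate⁺ _ _ ka , ∈-tabulate⁺ _ _ kb , ∈-tabulate⁺ _ _ kc
    ; new-in-subtree = λ i z m → new-in-subtree i z (∈-tabulate⁻ _ _ m)
    ; Q-clique = λ i x y x∈ y∈ x≢y → clique i x y (∈-tabulate⁻ _ _ x∈) (∈-tabulate⁻ _ _ y∈) x≢y
    ; cover = cover′
    ; share3 = λ i j x y z x≢y x≢z y≢z xi yi zi xj yj zj →
        share3 i j (x , y , z) (x≢y , x≢z , y≢z) (∈-tabulate⁻ _ _ xi , ∈-tabulate⁻ _ _ yi , ∈-tabulate⁻ _ _ zi)
               (∈-tabulate⁻ _ _ xj , ∈-tabulate⁻ _ _ yj , ∈-tabulate⁻ _ _ zj)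
    ; G-sym = E-sym }
    where
    cover′ : ∀ C → IsClique E C → ∃[ i ] C ⊆ Q i
    cover′ C C-clique with cover (λ x → does (x ∈? C))
                                (λ x y x∈ y∈ x≢y → C-clique x y (does-true (x ∈? C) x∈) (does-true (y ∈? C) y∈) x≢y)
    ... | i , C⊆i = i , λ {x} x∈ → ∈-tabulate⁺ (member ν fc i) x (C⊆i x (dec-true (x ∈? C) x∈))

-- A non-complete RAN has at least four vertices (on three vertices it is the triangle).
non-complete-RAN-size : ∀ {n} {G : Graph n} → IsRAN G → NonComplete G → ∃[ k ] n ≡ suc (suc (suc (suc k)))
non-complete-RAN-size {n} {G} (E , F , σ , st , G≡E) (u , v , u≢v , u≁v) with ran-size≥3 st
... | s≤s (s≤s (s≤s {n = zero} _)) = ⊥-elim (u≁v u~v)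
  where
  s⁻¹ : Fin n → Fin n
  s⁻¹ = σ ⟨$⟩ˡ_
  s⁻¹-≢ : s⁻¹ u ≢ s⁻¹ v
  s⁻¹-≢ e = u≢v (trans (sym (inverseʳ σ)) (trans (cong (σ ⟨$⟩ʳ_) e) (inverseʳ σ)))
  u~v : Adj G u v
  u~v = begin
    G u v                                           ≡⟨ cong₂ G (sym (inverseʳ σ)) (sym (inverseʳ σ)) ⟩
    G (σ ⟨$⟩ʳ (s⁻¹ u)) (σ ⟨$⟩ʳ (s⁻¹ v))            ≡⟨ G≡E (s⁻¹ u) (s⁻¹ v) ⟩
    E (s⁻¹ u) (s⁻¹ v)                               ≡⟨ cong (λ E′ → E′ (s⁻¹ u) (s⁻¹ v)) (ran-size-3 st) ⟩
    not (does (s⁻¹ u ≟ s⁻¹ v))                     ≡⟨ cong not (dec-false (s⁻¹ u ≟ s⁻¹ v) s⁻¹-≢) ⟩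
    true                                            ∎
    where open ≡-Reasoning
... | s≤s (s≤s (s≤s {n = suc k} _)) = k , refl

module RANCliqueTree {k : ℕ} {G : Graph (suc (suc (suc (suc k))))} (ran : IsRAN G) (CT : CliqueTree G) where
  open CliqueTree CT

  E : Graph (suc (suc (suc (suc k))))
  E = proj₁ ran
  σ : Permutation′ (suc (suc (suc (suc k))))
  σ = proj₁ (proj₂ (proj₂ ran))
  construction : RANState _ E (proj₁ (proj₂ ran))
  construction = proj₁ (proj₂ (proj₂ (proj₂ ran)))
  G∘σ≡E : ∀ u v → G (σ ⟨$⟩ʳ u) (σ ⟨$⟩ʳ v) ≡ E u v
  G∘σ≡E = proj₂ (proj₂ (proj₂ (proj₂ ran)))

  -- the construction yields a structure for E, which the relabelling σ carries to G
  module Relabelled = Relabel (FromInvariant.structure (invariant-of construction)) (σ ⟨$⟩ʳ_) (σ ⟨$⟩ˡ_)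
    (λ _ → inverseʳ σ) (λ _ → inverseˡ σ) (λ x y → trans (cong₂ G (sym (inverseʳ σ)) (sym (inverseʳ σ))) (G∘σ≡E _ _))
  module C = Cliques Relabelled.relabelled

  -- both families enumerate the maximal cliques bijectively
  π : Fin m → Fin (suc k)
  π q = proj₁ (C.maximal⇒Q (clique q) (maximal q))
  ρ : Fin (suc k) → Fin m
  ρ i = proj₁ (complete (Relabelled.Q′ i) (C.Q-maximal i))

  π-spec : ∀ q → Relabelled.Q′ (π q) ≡ clique q
  π-spec q = proj₂ (C.maximal⇒Q (clique q) (maximal q))
  ρ-spec : ∀ i → clique (ρ i) ≡ Relabelled.Q′ i
  ρ-spec i = proj₂ (complete (Relabelled.Q′ i) (C.Q-maximal i))

  π∘ρ : ∀ i → π (ρ i) ≡ i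
  π∘ρ i = C.Q-injective _ _ (trans (π-spec (ρ i)) (ρ-spec i))
  ρ∘π : ∀ q → ρ (π q) ≡ q
  ρ∘π q = injective _ _ (trans (ρ-spec (π q)) (π-spec q))

  structure : CliqueStructure G m clique
  structure = Reindex.reindexed Relabelled.relabelled clique π ρ π∘ρ ρ∘π (λ q → sym (π-spec q))

  m≡ : m ≡ suc k
  m≡ = HasCard-unique (Cliques.maximal-clique-count structure) C.maximal-clique-count

module Statements {k : ℕ} {G : Graph (suc (suc (suc (suc k))))} (ran : IsRAN G) (non-complete : NonComplete G) (CT : CliqueTree G) where
  open CliqueTree CT
  open RANCliqueTree ran CT using (structure; m≡)
  open Cliques structure
  open CliqueTreeIsT* CT structure using (tree≡T*)

  m∸1≡k : m ∸ 1 ≡ k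
  m∸1≡k = cong (_∸ 1) m≡

  degree-tree : ∀ q → degree tree q ≡ degree T* q
  degree-tree q = cong sum (List.map-cong (λ v → cong (λ b → if b then 1 else 0) (tree≡T* q v)) (allFin m))

  cliques : HasCard (IsMaximalClique G) (suc k)
  cliques = subst (HasCard (IsMaximalClique G)) m≡ maximal-clique-count

  tree-edges : HasCard IsTreeEdge k
  tree-edges = subst (HasCard IsTreeEdge) m∸1≡k
    (HasCard-⇔ (λ { (i , j) (i<j , ij) → i<j , trans (tree≡T* i j) ij })
               (λ { (i , j) (i<j , ij) → i<j , trans (sym (tree≡T* i j)) ij }) T*-edge-count)

  separators : HasCard (IsMinimalVertexSeparator G) k
  separators = subst (HasCard (IsMinimalVertexSeparator G)) m∸1≡k separator-count

  leaves-and-simplicial : ∃[ l ] (HasCard IsLeaf l × HasCard (IsSimplicial G) l)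
  leaves-and-simplicial = length leaves ,
    HasCard-⇔ (λ q deg1 → trans (degree-tree q) deg1) (λ q deg1 → trans (sym (degree-tree q)) deg1) leaf-count ,
    simplicial-count (non-complete⇒non-root non-complete)

  internal : ∀ q → IsInternal q → ∀ x → x ∈ clique q → ∃[ S ] (IsMinimalVertexSeparator G S × x ∈ S)
  internal q 2≤ = internal-in-separators q (subst (2 ≤_) (degree-tree q) 2≤)

  degree≤4 : ∀ q → degree tree q ≤ 4
  degree≤4 q = subst (_≤ 4) (sym (degree-tree q)) (T*-degree≤4 q)

mainTheorem1 : ∀ {n} (G : Graph n) → IsRAN G → NonComplete G →
    (T : CliqueTree G) →
    (CliqueTree.m T ≡ n ∸ 3 × HasCard (IsMaximalClique G) (n ∸ 3))
    × (HasCard (CliqueTree.IsTreeEdge T) (n ∸ 4)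
       × HasCard (IsMinimalVertexSeparator G) (n ∸ 4))
    × (∃[ k ] (HasCard (CliqueTree.IsLeaf T) k × HasCard (IsSimplicial G) k))
    × (∀ q → CliqueTree.IsInternal T q → ∀ x → x ∈ CliqueTree.clique T q →
         ∃[ S ] (IsMinimalVertexSeparator G S × x ∈ S))
    × (∀ q → degree (CliqueTree.tree T) q ≤ 4)
mainTheorem1 G ran non-complete T with non-complete-RAN-size ran non-complete
... | k , refl = (RANCliqueTree.m≡ ran T , cliques) , (tree-edges , separators) , leaves-and-simplicial , internal , degree≤4
  where open Statements ran non-complete T
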